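{- Let $X,Y$ be indeterminates, $b_k=2k+X+Y$ for $k\ge0$ and $\lambda_k=(k+X)(k-1+Y)$ for $k\ge1$. Then for every $n\ge0$, \[ \mu_n(b_k,\lambda_k)=\sum_{\pi\in\mathfrak S_n}(X+1)^{\mathrm{RLmin}(\pi)-\mathrm{pivot}(\pi)}(X+Y)^{\mathrm{pivot}(\pi)}Y^{\mathrm{LRmax}(\pi)-\mathrm{pivot}(\pi)} . \]
   Context: For sequences $(b_k)_{k\ge0}$, $(\lambda_k)_{k\ge1}$ let $p_n$ be the monic polynomials with $p_{ -1}=0$, $p_0=1$, $p_{n+1}=(x-b_n)p_n-\lambda_np_{n-1}$; $\mu_n(b_k,\lambda_k)$ denotes $\mathcal L(x^n)$, where $\mathcal L$ is the unique linear functional on polynomials with $\mathcal L(1)=1$ and $\mathcal L(p_m)=0$ for all $m\ge1$. $\mathfrak S_n$ is the set of permutations $\pi=\pi_1\cdots\pi_n$ of $\{1,\dots,n\}$. $\pi_i$ is a right-to-left minimum if $\pi_i<\pi_j$ for all $j>i$, and a left-to-right maximum if $\pi_i>\pi_j$ for all $j<i$; $\mathrm{RLmin}(\pi)$, $\mathrm{LRmax}(\pi)$ are their numbers. A pivot is an entry that is both a left-to-right maximum and a right-to-left minimum; $\mathrm{pivot}(\pi)$ is their number. -}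

module Defs where

open import Level using (Level)
open import Data.Bool using (Bool; true; false; not; _∧_; if_then_else_)
open import Data.Nat using (ℕ; zero; suc; _∸_; _<ᵇ_; _≡ᵇ_)
open import Data.List using (List; []; _∷_; _++_; [_]; map; concatMap; upTo; filterᵇ)
open import Data.Bool.ListAction using (all; any)
open import Data.Product using (_×_; _,_; proj₂)
open import Algebra.Bundles using (CommutativeRing)

-- Permutations of {1,…,n}, written in one-line notation π₁⋯πₙ.

words : ℕ → ℕ → List (List ℕ)
words n zero    = [] ∷ []
words n (suc k) = concatMap (λ w → map (λ a → a ∷ w) (map suc (upTo n))) (words n k)

distinct : List ℕ → Bool
distinct []       = true
distinct (x ∷ xs) = not (any (λ y → x ≡ᵇ y) xs) ∧ distinct xs

perms : ℕ → List (List ℕ)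
perms n = filterᵇ distinct (words n n)

one? : Bool → ℕ
one? true  = 1
one? false = 0

RLmin : List ℕ → ℕ
RLmin []       = 0
RLmin (x ∷ xs) = one? (all (λ y → x <ᵇ y) xs) Data.Nat.+ RLmin xs

-- number of left-to-right maxima; first argument = entries to the left
LRmaxFrom : List ℕ → List ℕ → ℕ
LRmaxFrom pre []       = 0
LRmaxFrom pre (x ∷ xs) = one? (all (λ y → y <ᵇ x) pre) Data.Nat.+ LRmaxFrom (pre ++ [ x ]) xs

LRmax : List ℕ → ℕ
LRmax = LRmaxFrom []

pivotFrom : List ℕ → List ℕ → ℕ
pivotFrom pre []       = 0
pivotFrom pre (x ∷ xs) =
  one? (all (λ y → y <ᵇ x) pre ∧ all (λ y → x <ᵇ y) xs) Data.Nat.+ pivotFrom (pre ++ [ x ]) xs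

pivot : List ℕ → ℕ
pivot = pivotFrom []

-- Everything over an arbitrary commutative ring R (X, Y are arbitrary
-- elements of R; taking R = ℤ[X,Y] recovers the indeterminate case).

module OverRing {c ℓ : Level} (R : CommutativeRing c ℓ) where
  open CommutativeRing R

  nat : ℕ → Carrier
  nat zero    = 0#
  nat (suc n) = 1# + nat n

  pow : Carrier → ℕ → Carrier
  pow a zero    = 1#
  pow a (suc n) = a * pow a n

  sumR : List Carrier → Carrier
  sumR []       = 0#
  sumR (a ∷ as) = a + sumR as

  -- polynomials in x over R: coefficient lists, constant term first
  Poly : Set c
  Poly = List Carrier

  _⊕_ : Poly → Poly → Poly
  []       ⊕ g        = g
  (a ∷ f)  ⊕ []       = a ∷ f
  (a ∷ f)  ⊕ (b ∷ g)  = (a + b) ∷ (f ⊕ g)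

  _⊛_ : Carrier → Poly → Poly
  r ⊛ f = map (λ a → r * a) f

  xMul : Poly → Poly
  xMul f = 0# ∷ f

  module Seq (X Y : Carrier) where
    b : ℕ → Carrier
    b k = (nat (2 Data.Nat.* k) + X) + Y

    -- λ_k = (k + X)(k - 1 + Y) for k ≥ 1  (λ_0 is never used: it multiplies p_{-1} = 0)
    lam : ℕ → Carrier
    lam zero    = 0#
    lam (suc j) = (nat (suc j) + X) * (nat j + Y)

    -- (p_{n-1}, p_n), with p_{-1} = 0, p_0 = 1,
    -- p_{n+1} = (x - b_n) p_n - λ_n p_{n-1}
    pair : ℕ → Poly × Poly
    pair zero = ([] , 1# ∷ [])
    pair (suc n) with pair n
    ... | (prev , cur) = (cur , ((xMul cur ⊕ ((- b n) ⊛ cur)) ⊕ ((- lam n) ⊛ prev)))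

    p : ℕ → Poly
    p n = proj₂ (pair n)

    rhs : ℕ → Carrier
    rhs n = sumR (map (λ π → (pow (X + 1#) (RLmin π ∸ pivot π) * pow (X + Y) (pivot π))
                               * pow Y (LRmax π ∸ pivot π))
                      (perms n))

  -- The linear functional 𝓛 on R[x] with moments m (𝓛(xⁱ) = m i),
  -- applied to a polynomial: 𝓛(Σ aᵢ xⁱ) = Σ aᵢ m i.
  applyFrom : (ℕ → Carrier) → ℕ → Poly → Carrier
  applyFrom m i []       = 0#
  applyFrom m i (a ∷ f)  = a * m i + applyFrom m (suc i) f

  𝓛 : (ℕ → Carrier) → Poly → Carrier
  𝓛 m = applyFrom m 0

-- Flajolet–Viennot: splitting λₖ₊₁ = (k+1+X)(k+Y) into an up step and a down step, the
-- moments become weighted Motzkin paths, 𝓛(xⁿ pₖ) = (1+X)⋯(k+X) · pathSum n k.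
--
-- The weight (X+1)^(RLmin−pivot) (X+Y)^pivot Y^(LRmax−pivot) of a permutation is a product
-- over its entries: X+Y for a pivot, Y for another left-to-right maximum, X+1 for another
-- right-to-left minimum, 1 otherwise.  Build the permutation by inserting 1, 2, …, n; at
-- stage i every maximal block of entries > i is a single gap, and inserting i+1 replaces one
-- gap by i+1, (i+1)□, □(i+1) or □(i+1)□ (squashing undoes this, so each word arises exactly
-- once).  The new entry is a left-to-right maximum iff it comes first in a gap preceded only
-- by values, and a right-to-left minimum iff it comes last in a gap ending the word.  Hence the
-- weight collected by k further insertions depends only on the number r of gaps and on
-- whether the word ends with one; this completion weight satisfies
-- completion k (r+1) true + completion k r false = pathSum k r, as both sides obey the same
-- recursion in k, and stage 0 is a single gap.

module Submission where

open import Defs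
open import Level using (Level)
open import Algebra.Bundles using (CommutativeRing)

module Combinatorics where

  open import Data.Bool using (Bool; true; false; T; not; _∧_)
  open import Data.Bool.Properties using (∧-assoc; ∧-zeroʳ; ∧-identityʳ)
  open import Data.Bool.ListAction using (all; any)
  open import Data.Empty using (⊥; ⊥-elim)
  open import Data.List using (List; []; _∷_; _++_; [_]; map; null; length; upTo; concatMap; filter)
  open import Data.List.Properties using (≡-dec; length-map; length-upTo; map-injective)
  open import Data.List.Membership.Propositional using (_∈_)
  import Data.List.Membership.Propositional.Properties as ∈
  open import Data.List.Relation.Unary.All using (All; []; _∷_)
  import Data.List.Relation.Unary.All as All
  import Data.List.Relation.Unary.All.Properties as All
  open import Data.List.Relation.Unary.AllPairs using ([]; _∷_)
  open import Data.List.Relation.Unary.Any using (here; there)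
  import Data.List.Relation.Unary.Any as Any
  open import Data.List.Relation.Unary.Any.Properties using (any⁺; any⁻)
  open import Data.List.Relation.Unary.Unique.Propositional using (Unique)
  import Data.List.Relation.Unary.Unique.Propositional.Properties as Unique
  open import Data.Nat using (ℕ; zero; suc; _+_; _*_; _≤_; _<_; _≤ᵇ_; _<ᵇ_; _≡ᵇ_; z≤n; s≤s; _≟_; _≤?_; _<?_)
  import Data.Nat.Properties as ℕ
  open import Data.List.Membership.DecPropositional _≟_ using (_∈?_)
  open import Data.Product using (_×_; _,_; proj₁; proj₂; Σ-syntax)
  open import Data.Sum using (_⊎_; inj₁; inj₂)
  open import Data.Unit using (⊤; tt)
  open import Function using (_∘_; mk⇔)
  open import Relation.Binary.Definitions using (DecidableEquality; tri<; tri≈; tri>)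
  open import Relation.Binary.PropositionalEquality using (_≡_; _≢_; refl; sym; trans; cong; cong₂; subst; module ≡-Reasoning)
  open import Relation.Nullary using (yes; no; does)
  import Relation.Nullary.Decidable as Dec
  open import Relation.Nullary.Decidable using (T?; dec-true; dec-false)
  open import Relation.Unary using (Decidable)

  -- Words with gaps

  -- At stage i a permutation is seen through its entries ≤ i; every maximal
  -- block of larger entries is collapsed to a single gap.
  data Letter : Set where
    gap : Letter
    val : ℕ → Letter

  Word : Set
  Word = List Letter

  val-injective : ∀ {u v} → val u ≡ val v → u ≡ v
  val-injective refl = refl

  _≟ˡ_ : DecidableEquality Letter
  gap   ≟ˡ gap   = yes refl
  gap   ≟ˡ val _ = no λ ()
  val _ ≟ˡ gap   = no λ ()
  val u ≟ˡ val v = Dec.map′ (cong val) val-injective (u ≟ v)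

  _≟ʷ_ : DecidableEquality Word
  _≟ʷ_ = ≡-dec _≟ˡ_

  gapCount : Word → ℕ
  gapCount []          = 0
  gapCount (gap ∷ t)   = suc (gapCount t)
  gapCount (val _ ∷ t) = gapCount t

  values : Word → List ℕ
  values []          = []
  values (gap ∷ t)   = values t
  values (val u ∷ t) = u ∷ values t

  isValue : Letter → Bool
  isValue gap     = false
  isValue (val _) = true

  endsWithGap : Word → Bool
  endsWithGap []          = false
  endsWithGap (x ∷ [])    = not (isValue x)
  endsWithGap (_ ∷ y ∷ t) = endsWithGap (y ∷ t)

  -- a gap stands for entries larger than all values present
  isBelow : ℕ → Letter → Bool
  isBelow v gap     = false
  isBelow v (val u) = u <ᵇ v

  isAbove : ℕ → Letter → Bool
  isAbove v gap     = true
  isAbove v (val u) = v <ᵇ u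

  consGap : Word → Word
  consGap []          = gap ∷ []
  consGap (gap ∷ t)   = gap ∷ t
  consGap (val u ∷ t) = gap ∷ val u ∷ t

  squash : ℕ → Word → Word
  squash i []          = []
  squash i (gap ∷ t)   = consGap (squash i t)
  squash i (val u ∷ t) with u ≤ᵇ i
  ... | true  = val u ∷ squash i t
  ... | false = consGap (squash i t)

  insertions : ℕ → Word → List Word
  insertions v []          = []
  insertions v (gap ∷ g)   =
    (val v ∷ g) ∷ (val v ∷ gap ∷ g) ∷ (gap ∷ val v ∷ g) ∷ (gap ∷ val v ∷ gap ∷ g)
    ∷ map (gap ∷_) (insertions v g)
  insertions v (val u ∷ g) = map (val u ∷_) (insertions v g)

  NoAdjacentGaps : Word → Set
  NoAdjacentGaps []                = ⊤
  NoAdjacentGaps (val _ ∷ t)       = NoAdjacentGaps t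
  NoAdjacentGaps (gap ∷ [])        = ⊤
  NoAdjacentGaps (gap ∷ gap ∷ _)   = ⊥
  NoAdjacentGaps (gap ∷ val _ ∷ t) = NoAdjacentGaps t

  SoleMaximum : ℕ → Word → Set
  SoleMaximum v []          = ⊥
  SoleMaximum v (gap ∷ t)   = SoleMaximum v t
  SoleMaximum v (val u ∷ t) = (u < v × SoleMaximum v t) ⊎ (u ≡ v × All (_< v) (values t))

  all-++ : ∀ {A : Set} (f : A → Bool) a c → all f (a ++ c) ≡ all f a ∧ all f c
  all-++ f []      c = refl
  all-++ f (x ∷ a) c = trans (cong (f x ∧_) (all-++ f a c)) (sym (∧-assoc (f x) (all f a) (all f c)))

  gapCount-++ : ∀ a c → gapCount (a ++ c) ≡ gapCount a + gapCount c
  gapCount-++ []          c = refl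
  gapCount-++ (gap ∷ a)   c = cong suc (gapCount-++ a c)
  gapCount-++ (val _ ∷ a) c = gapCount-++ a c

  endsWithGap-++ : ∀ a t c → endsWithGap (a ++ t ∷ c) ≡ endsWithGap (t ∷ c)
  endsWithGap-++ []          t c = refl
  endsWithGap-++ (x ∷ [])    t c = refl
  endsWithGap-++ (x ∷ y ∷ a) t c = endsWithGap-++ (y ∷ a) t c

  values-++ : ∀ a c → values (a ++ c) ≡ values a ++ values c
  values-++ []          c = refl
  values-++ (gap ∷ a)   c = values-++ a c
  values-++ (val u ∷ a) c = cong (u ∷_) (values-++ a c)

  values-snoc< : ∀ {v} pre t → All (_< v) (values pre) → All (_< v) (values [ t ]) → All (_< v) (values (pre ++ [ t ]))
  values-snoc< {v} pre t pre<v t<v = subst (All (_< v)) (sym (values-++ pre [ t ])) (All.++⁺ pre<v t<v)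

  values-consGap : ∀ t → values (consGap t) ≡ values t
  values-consGap []          = refl
  values-consGap (gap ∷ t)   = refl
  values-consGap (val u ∷ t) = refl

  consGap-idem : ∀ t → consGap (consGap t) ≡ consGap t
  consGap-idem []          = refl
  consGap-idem (gap ∷ t)   = refl
  consGap-idem (val u ∷ t) = refl

  NoAdjacentGaps-consGap : ∀ t → NoAdjacentGaps t → NoAdjacentGaps (consGap t)
  NoAdjacentGaps-consGap []          _  = tt
  NoAdjacentGaps-consGap (gap ∷ t)   na = na
  NoAdjacentGaps-consGap (val u ∷ t) na = na

  NoAdjacentGaps-tail : ∀ t → NoAdjacentGaps (gap ∷ t) → NoAdjacentGaps t
  NoAdjacentGaps-tail []          _  = tt
  NoAdjacentGaps-tail (val u ∷ t) na = na

  SoleMaximum-consGap : ∀ v t → SoleMaximum v t → SoleMaximum v (consGap t)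
  SoleMaximum-consGap v (gap ∷ t)   sm = sm
  SoleMaximum-consGap v (val u ∷ t) sm = sm

  endsWithGap-gapless : ∀ g → gapCount g ≡ 0 → endsWithGap g ≡ false
  endsWithGap-gapless []              _ = refl
  endsWithGap-gapless (val u ∷ [])    _ = refl
  endsWithGap-gapless (val u ∷ t ∷ g) n = endsWithGap-gapless (t ∷ g) n

  data TailShape (g : Word) : Set where
    gapless : gapCount g ≡ 0 → endsWithGap (gap ∷ g) ≡ null g → TailShape g
    gapped  : ∀ j → gapCount g ≡ suc j → null g ≡ false → endsWithGap (gap ∷ g) ≡ endsWithGap g → TailShape g

  tailShape : ∀ g → TailShape g
  tailShape []      = gapless refl refl
  tailShape (t ∷ g) with gapCount (t ∷ g) in n
  ... | zero  = gapless n (endsWithGap-gapless (t ∷ g) n)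
  ... | suc j = gapped j n refl refl

  endsWithGap-val∷ : ∀ v g → endsWithGap (val v ∷ g) ≡ endsWithGap (gap ∷ g) ∧ not (null g)
  endsWithGap-val∷ v []      = refl
  endsWithGap-val∷ v (t ∷ g) = sym (∧-identityʳ _)

  squash-below : ∀ i u t → u < suc i → squash i (val u ∷ t) ≡ val u ∷ squash i t
  squash-below i u t u<1+i rewrite dec-true (u ≤? i) (ℕ.≤-pred u<1+i) = refl

  squash-above : ∀ i u t → i < u → squash i (val u ∷ t) ≡ consGap (squash i t)
  squash-above i u t i<u rewrite dec-false (u ≤? i) (ℕ.<⇒≱ i<u) = refl

  squash-consGap : ∀ i t → squash i (consGap t) ≡ consGap (squash i t)
  squash-consGap i []          = refl
  squash-consGap i (gap ∷ t)   = sym (consGap-idem (squash i t))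
  squash-consGap i (val u ∷ t) = refl

  squash-squash : ∀ i t → squash i (squash (suc i) t) ≡ squash i t
  squash-squash i []          = refl
  squash-squash i (gap ∷ t)   = trans (squash-consGap i (squash (suc i) t)) (cong consGap (squash-squash i t))
  squash-squash i (val u ∷ t) with ℕ.<-cmp u (suc i)
  ... | tri< u<1+i _ _ =
    trans (cong (squash i) (squash-below (suc i) u t (ℕ.m≤n⇒m≤1+n u<1+i)))
          (trans (squash-below i u _ u<1+i) (trans (cong (val u ∷_) (squash-squash i t)) (sym (squash-below i u t u<1+i))))
  ... | tri≈ _ refl _ =
    trans (cong (squash i) (squash-below (suc i) u t (ℕ.n<1+n u)))
          (trans (squash-above i u _ (ℕ.n<1+n i)) (trans (cong consGap (squash-squash i t)) (sym (squash-above i u t (ℕ.n<1+n i)))))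
  ... | tri> _ _ 1+i<u =
    trans (cong (squash i) (squash-above (suc i) u t 1+i<u))
          (trans (squash-consGap i (squash (suc i) t))
                 (trans (cong consGap (squash-squash i t)) (sym (squash-above i u t (ℕ.<-trans (ℕ.n<1+n i) 1+i<u)))))

  NoAdjacentGaps-squash : ∀ i t → NoAdjacentGaps (squash i t)
  NoAdjacentGaps-squash i []          = tt
  NoAdjacentGaps-squash i (gap ∷ t)   = NoAdjacentGaps-consGap (squash i t) (NoAdjacentGaps-squash i t)
  NoAdjacentGaps-squash i (val u ∷ t) with u ≤ᵇ i
  ... | true  = NoAdjacentGaps-squash i t
  ... | false = NoAdjacentGaps-consGap (squash i t) (NoAdjacentGaps-squash i t)

  squash-id : ∀ i t → NoAdjacentGaps t → All (_< suc i) (values t) → squash i t ≡ t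
  squash-id i []                _  _                  = refl
  squash-id i (gap ∷ [])        _  _                  = refl
  squash-id i (gap ∷ val u ∷ t) na u<                 = cong consGap (squash-id i (val u ∷ t) na u<)
  squash-id i (val u ∷ t)       na (u<1+i ∷ values<) =
    trans (squash-below i u t u<1+i) (cong (val u ∷_) (squash-id i t na values<))

  squash-top : ∀ i t → NoAdjacentGaps t → All (_< suc i) (values t) → squash i (val (suc i) ∷ t) ≡ consGap t
  squash-top i t na t< = trans (squash-above i (suc i) t (ℕ.n<1+n i)) (cong consGap (squash-id i t na t<))

  values-squash< : ∀ v w → All (v ≢_) w → All (_< v) (values (squash v (map val w)))
  values-squash< v []      _              = []
  values-squash< v (u ∷ w) (v≢u ∷ v∉w) with ℕ.<-cmp u v
  ... | tri< u<v _ _ rewrite squash-below v u (map val w) (ℕ.m<n⇒m<1+n u<v) = u<v ∷ values-squash< v w v∉w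
  ... | tri≈ _ u≡v _ = ⊥-elim (v≢u (sym u≡v))
  ... | tri> _ _ v<u rewrite squash-above v u (map val w) v<u | values-consGap (squash v (map val w)) = values-squash< v w v∉w

  squash-SoleMaximum : ∀ v w → Unique w → v ∈ w → SoleMaximum v (squash v (map val w))
  squash-SoleMaximum v (u ∷ w) (u∉w ∷ !w) v∈u∷w with ℕ.<-cmp u v
  ... | tri< u<v u≢v _ rewrite squash-below v u (map val w) (ℕ.m<n⇒m<1+n u<v) =
    inj₁ (u<v , squash-SoleMaximum v w !w (Any.tail (λ v≡u → u≢v (sym v≡u)) v∈u∷w))
  ... | tri≈ _ refl _ rewrite squash-below v v (map val w) (ℕ.n<1+n v) = inj₂ (refl , values-squash< v w u∉w)
  ... | tri> _ _ v<u rewrite squash-above v u (map val w) v<u =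
    SoleMaximum-consGap v (squash v (map val w)) (squash-SoleMaximum v w !w (Any.tail (λ v≡u → ℕ.<-irrefl v≡u v<u) v∈u∷w))

  consGap-squash₀ : ∀ π → All (1 ≤_) π → consGap (squash 0 (map val π)) ≡ gap ∷ []
  consGap-squash₀ []          _            = refl
  consGap-squash₀ (suc x ∷ π) (_ ∷ 1≤π) =
    trans (consGap-idem (squash 0 (map val π))) (consGap-squash₀ π 1≤π)

  squash₀ : ∀ x π → All (1 ≤_) (x ∷ π) → squash 0 (map val (x ∷ π)) ≡ gap ∷ []
  squash₀ (suc x) π (_ ∷ 1≤π) = consGap-squash₀ π 1≤π

  one?-∧ : ∀ a b → one? (a ∧ b) ≡ one? a * one? b
  one?-∧ true  true  = refl
  one?-∧ true  false = refl
  one?-∧ false b     = refl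

  occurrences : ∀ {A : Set} → DecidableEquality A → A → List A → ℕ
  occurrences _≟_ x []      = 0
  occurrences _≟_ x (y ∷ L) = one? (does (x ≟ y)) + occurrences _≟_ x L

  module _ {A : Set} (_≟_ : DecidableEquality A) where

    private
      _≟ᴸ_ : DecidableEquality (List A)
      _≟ᴸ_ = ≡-dec _≟_

    does-≟-sym : ∀ x y → does (x ≟ y) ≡ does (y ≟ x)
    does-≟-sym x y = Dec.does-⇔ (mk⇔ sym sym) (x ≟ y) (y ≟ x)

    occurrences-++ : ∀ x L M → occurrences _≟_ x (L ++ M) ≡ occurrences _≟_ x L + occurrences _≟_ x M
    occurrences-++ x []      M = refl
    occurrences-++ x (y ∷ L) M =
      trans (cong (one? (does (x ≟ y)) +_) (occurrences-++ x L M)) (sym (ℕ.+-assoc (one? (does (x ≟ y))) _ _))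

    occurrences-filter : ∀ {P : A → Set} (P? : Decidable P) {x} → P x → ∀ L →
                         occurrences _≟_ x (filter P? L) ≡ occurrences _≟_ x L
    occurrences-filter P? Px []      = refl
    occurrences-filter P? {x} Px (y ∷ L) with does (P? y) in P?y
    ... | true  = cong (_ +_) (occurrences-filter P? Px L)
    ... | false with x ≟ y
    ...   | no _     = occurrences-filter P? Px L
    ...   | yes refl with () ← trans (sym P?y) (dec-true (P? x) Px)

    occurrences-∉ : ∀ x L → All (x ≢_) L → occurrences _≟_ x L ≡ 0
    occurrences-∉ x []      _            = refl
    occurrences-∉ x (y ∷ L) (x≢y ∷ x∉L) rewrite dec-false (x ≟ y) x≢y = occurrences-∉ x L x∉L

    occurrences-Unique : ∀ x L → Unique L → x ∈ L → occurrences _≟_ x L ≡ 1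
    occurrences-Unique x (y ∷ L) (y∉L ∷ _)  (here refl) rewrite dec-true (x ≟ x) refl =
      cong suc (occurrences-∉ x L y∉L)
    occurrences-Unique x (y ∷ L) (y∉L ∷ !L) (there x∈L)
      rewrite dec-false (x ≟ y) (λ x≡y → All.lookup y∉L x∈L (sym x≡y)) = occurrences-Unique x L !L x∈L

    occurrences-map-∷-≡ : ∀ x y s L → does (x ≟ y) ≡ true →
                          occurrences _≟ᴸ_ (x ∷ s) (map (y ∷_) L) ≡ occurrences _≟ᴸ_ s L
    occurrences-map-∷-≡ x y s []      x≡y = refl
    occurrences-map-∷-≡ x y s (h ∷ L) x≡y rewrite x≡y = cong (one? (does (s ≟ᴸ h)) +_) (occurrences-map-∷-≡ x y s L x≡y)

    occurrences-map-∷-≢ : ∀ x y s L → does (x ≟ y) ≡ false → occurrences _≟ᴸ_ (x ∷ s) (map (y ∷_) L) ≡ 0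
    occurrences-map-∷-≢ x y s []      x≢y = refl
    occurrences-map-∷-≢ x y s (h ∷ L) x≢y rewrite x≢y = occurrences-map-∷-≢ x y s L x≢y

    occurrences-map-∷ʳ : ∀ x s u L → occurrences _≟ᴸ_ (x ∷ s) (map (_∷ u) L) ≡ occurrences _≟_ x L * one? (does (s ≟ᴸ u))
    occurrences-map-∷ʳ x s u []      = refl
    occurrences-map-∷ʳ x s u (a ∷ L) =
      trans (cong₂ _+_ (one?-∧ (does (x ≟ a)) _) (occurrences-map-∷ʳ x s u L))
            (sym (ℕ.*-distribʳ-+ (one? (does (s ≟ᴸ u))) (one? (does (x ≟ a))) _))

  gap∷-≟-gapless : ∀ s g → NoAdjacentGaps (gap ∷ g) → does ((gap ∷ s) ≟ʷ g) ≡ false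
  gap∷-≟-gapless s []          _ = refl
  gap∷-≟-gapless s (val u ∷ g) _ = refl

  consGap-≟-gapless : ∀ t g → NoAdjacentGaps (gap ∷ g) → does (consGap t ≟ʷ g) ≡ false
  consGap-≟-gapless []          []          _ = refl
  consGap-≟-gapless (gap ∷ t)   []          _ = refl
  consGap-≟-gapless (val _ ∷ t) []          _ = refl
  consGap-≟-gapless []          (val u ∷ g) _ = refl
  consGap-≟-gapless (gap ∷ t)   (val u ∷ g) _ = refl
  consGap-≟-gapless (val _ ∷ t) (val u ∷ g) _ = refl

  consGap-≟-gap∷ : ∀ t g → NoAdjacentGaps (gap ∷ g) →
    one? (does (t ≟ʷ g)) + one? (does (t ≟ʷ (gap ∷ g))) ≡ one? (does (consGap t ≟ʷ (gap ∷ g)))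
  consGap-≟-gap∷ []          g na = ℕ.+-identityʳ _
  consGap-≟-gap∷ (gap ∷ t)   g na rewrite gap∷-≟-gapless t g na = refl
  consGap-≟-gap∷ (val x ∷ t) g na = ℕ.+-identityʳ _

  occurrences-insertions :
    ∀ i g t → NoAdjacentGaps g → All (_< suc i) (values g) → NoAdjacentGaps t → SoleMaximum (suc i) t →
    occurrences _≟ʷ_ t (insertions (suc i) g) ≡ one? (does (squash i t ≟ʷ g))
  occurrences-insertions i [] (gap ∷ t) _ _ _ _ rewrite consGap-≟-gapless (squash i t) [] tt = refl
  occurrences-insertions i [] (val u ∷ t) _ _ _ (inj₁ (u<1+i , _)) rewrite squash-below i u t u<1+i = refl
  occurrences-insertions i [] (val u ∷ t) _ _ _ (inj₂ (refl , _))
    rewrite squash-above i u t (ℕ.n<1+n i) | consGap-≟-gapless (squash i t) [] tt = refl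
  occurrences-insertions i (val u ∷ g) (gap ∷ t) nag _ _ _ =
    trans (occurrences-map-∷-≢ _≟ˡ_ gap (val u) t (insertions (suc i) g) refl)
          (cong one? (sym (consGap-≟-gapless (squash i t) (val u ∷ g) nag)))
  occurrences-insertions i (val u ∷ g) (val x ∷ t) nag (_ ∷ g<) nat (inj₁ (x<1+i , max))
    rewrite squash-below i x t x<1+i with x ≡ᵇ u in x≡ᵇu
  ... | true  = trans (occurrences-map-∷-≡ _≟ˡ_ (val x) (val u) t (insertions (suc i) g) x≡ᵇu)
                      (occurrences-insertions i g t nag g< nat max)
  ... | false = occurrences-map-∷-≢ _≟ˡ_ (val x) (val u) t (insertions (suc i) g) x≡ᵇu
  occurrences-insertions i (val u ∷ g) (val _ ∷ t) nag (u<1+i ∷ _) _ (inj₂ (refl , _))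
    rewrite squash-above i (suc i) t (ℕ.n<1+n i) | consGap-≟-gapless (squash i t) (val u ∷ g) nag =
    occurrences-map-∷-≢ _≟ˡ_ (val (suc i)) (val u) t (insertions (suc i) g) (dec-false (suc i ≟ u) (ℕ.>⇒≢ u<1+i))
  occurrences-insertions i (gap ∷ g) (val x ∷ t) _ _ _ (inj₁ (x<1+i , _))
    rewrite squash-below i x t x<1+i | dec-false (x ≟ suc i) (ℕ.<⇒≢ x<1+i)
          | occurrences-map-∷-≢ _≟ˡ_ (val x) gap t (insertions (suc i) g) refl = refl
  occurrences-insertions i (gap ∷ g) (val _ ∷ t) nag _ nat (inj₂ (refl , t<))
    rewrite squash-top i t nat t< | dec-true (suc i ≟ suc i) refl
          | occurrences-map-∷-≢ _≟ˡ_ (val (suc i)) gap t (insertions (suc i) g) refl =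
    trans (cong (one? (does (t ≟ʷ g)) +_) (ℕ.+-identityʳ _)) (consGap-≟-gap∷ t g nag)
  occurrences-insertions i (gap ∷ g) (gap ∷ [])  _ _ _ ()
  occurrences-insertions i (gap ∷ g) (gap ∷ val x ∷ t) nag g< nat (inj₁ (x<1+i , max))
    rewrite dec-false (x ≟ suc i) (ℕ.<⇒≢ x<1+i) | occurrences-map-∷-≡ _≟ˡ_ gap gap (val x ∷ t) (insertions (suc i) g) refl
          | squash-below i x t x<1+i =
    trans (occurrences-insertions i g (val x ∷ t) (NoAdjacentGaps-tail g nag) g< nat (inj₁ (x<1+i , max)))
          (cong (λ s → one? (does (s ≟ʷ g))) (squash-below i x t x<1+i))
  occurrences-insertions i (gap ∷ g) (gap ∷ val _ ∷ t) nag g< nat (inj₂ (refl , t<))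
    rewrite dec-true (suc i ≟ suc i) refl | occurrences-map-∷-≡ _≟ˡ_ gap gap (val (suc i) ∷ t) (insertions (suc i) g) refl
          | squash-top i t nat t< | consGap-idem t =
    trans (cong (λ n → one? (does (t ≟ʷ g)) + (one? (does (t ≟ʷ (gap ∷ g))) + n)) later)
          (trans (cong (one? (does (t ≟ʷ g)) +_) (ℕ.+-identityʳ _)) (consGap-≟-gap∷ t g nag))
    where
    later : occurrences _≟ʷ_ (val (suc i) ∷ t) (insertions (suc i) g) ≡ 0
    later = trans (occurrences-insertions i g (val (suc i) ∷ t) (NoAdjacentGaps-tail g nag) g< nat (inj₂ (refl , t<)))
                  (cong one? (trans (cong (λ s → does (s ≟ʷ g)) (squash-top i t nat t<)) (consGap-≟-gapless t g nag)))

  InRange : ℕ → ℕ → Set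
  InRange n u = 1 ≤ u × u ≤ n

  IsPerm : ℕ → List ℕ → Set
  IsPerm n π = length π ≡ n × All (InRange n) π × Unique π

  Stage : ℕ → Word → Set
  Stage i g = NoAdjacentGaps g × IsPerm i (values g)

  Stage-values< : ∀ i g → Stage i g → All (_< suc i) (values g)
  Stage-values< i g (_ , _ , inRange , _) = All.map (λ u∈ → s≤s (proj₂ u∈)) inRange

  Inserts : ℕ → Word → Word → Set
  Inserts v g h = NoAdjacentGaps h × Σ[ a ∈ List ℕ ] Σ[ c ∈ List ℕ ] (values g ≡ a ++ c × values h ≡ a ++ v ∷ c)

  Inserts-val∷ : ∀ v u g h → Inserts v g h → Inserts v (val u ∷ g) (val u ∷ h)
  Inserts-val∷ v u g h (na , a , c , g≡ , h≡) = na , u ∷ a , c , cong (u ∷_) g≡ , cong (u ∷_) h≡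

  insertions-Inserts : ∀ v g → NoAdjacentGaps g → All (Inserts v g) (insertions v g)
  insertions-Inserts v []                _  = []
  insertions-Inserts v (gap ∷ [])        _  =
    (tt , [] , [] , refl , refl) ∷ (tt , [] , [] , refl , refl) ∷ (tt , [] , [] , refl , refl) ∷ (tt , [] , [] , refl , refl) ∷ []
  insertions-Inserts v (gap ∷ val u ∷ g) na =
    (na , [] , _ , refl , refl) ∷ (na , [] , _ , refl , refl) ∷ (na , [] , _ , refl , refl) ∷ (na , [] , _ , refl , refl) ∷
    All.map⁺ (All.map⁺ (All.map (λ {h} → Inserts-val∷ v u g h) (insertions-Inserts v g na)))
  insertions-Inserts v (val u ∷ g)       na = All.map⁺ (All.map (λ {h} → Inserts-val∷ v u g h) (insertions-Inserts v g na))

  length-insert : ∀ (a c : List ℕ) v → length (a ++ v ∷ c) ≡ suc (length (a ++ c))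
  length-insert []      c v = refl
  length-insert (x ∷ a) c v = cong suc (length-insert a c v)

  All-insert : ∀ {P : ℕ → Set} (a c : List ℕ) {v} → All P (a ++ c) → P v → All P (a ++ v ∷ c)
  All-insert a c Pac Pv = All.++⁺ (All.++⁻ˡ a Pac) (Pv ∷ All.++⁻ʳ a Pac)

  Unique-insert : ∀ (a c : List ℕ) {v} → Unique (a ++ c) → All (v ≢_) (a ++ c) → Unique (a ++ v ∷ c)
  Unique-insert []      c !c         v∉c         = v∉c ∷ !c
  Unique-insert (x ∷ a) c (x∉ ∷ !ac) (v≢x ∷ v∉) =
    All-insert a c x∉ (λ x≡v → v≢x (sym x≡v)) ∷ Unique-insert a c !ac v∉

  IsPerm-insert : ∀ i (a c : List ℕ) → IsPerm i (a ++ c) → IsPerm (suc i) (a ++ suc i ∷ c)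
  IsPerm-insert i a c (len , inRange , !ac) =
    trans (length-insert a c (suc i)) (cong suc len) ,
    All-insert a c (All.map (λ (1≤u , u≤i) → 1≤u , ℕ.m≤n⇒m≤1+n u≤i) inRange) (s≤s z≤n , ℕ.≤-refl) ,
    Unique-insert a c !ac (All.map (λ (_ , u≤i) 1+i≡u → ℕ.<-irrefl (sym 1+i≡u) (s≤s u≤i)) inRange)

  insertions-Stage : ∀ i g → Stage i g → All (Stage (suc i)) (insertions (suc i) g)
  insertions-Stage i g (na , isPerm) = All.map (λ {h} → step {h}) (insertions-Inserts (suc i) g na)
    where
    step : ∀ {h} → Inserts (suc i) g h → Stage (suc i) h
    step (nah , a , c , g≡ , h≡) = nah , subst (IsPerm (suc i)) (sym h≡) (IsPerm-insert i a c (subst (IsPerm i) g≡ isPerm))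

  _≟ᴺ_ : DecidableEquality (List ℕ)
  _≟ᴺ_ = ≡-dec _≟_

  alphabet : ℕ → List ℕ
  alphabet n = map suc (upTo n)

  alphabet-InRange : ∀ n → All (InRange n) (alphabet n)
  alphabet-InRange n = All.map⁺ (All.applyUpTo⁺₁ (λ u → u) n (λ u<n → s≤s z≤n , u<n))

  InRange⇒∈alphabet : ∀ n {u} → InRange n u → u ∈ alphabet n
  InRange⇒∈alphabet n {suc u} (_ , u<n) = ∈.∈-map⁺ suc (∈.∈-upTo⁺ u<n)

  alphabet-Unique : ∀ n → Unique (alphabet n)
  alphabet-Unique n = Unique.map⁺ ℕ.suc-injective (Unique.upTo⁺ n)

  words-shape : ∀ n k → All (λ w → length w ≡ k × All (InRange n) w) (words n k)
  words-shape n zero    = (refl , []) ∷ []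
  words-shape n (suc k) = All.concat⁺ (All.map⁺ (All.map extend (words-shape n k)))
    where
    extend : ∀ {w} → length w ≡ k × All (InRange n) w →
             All (λ aw → length aw ≡ suc k × All (InRange n) aw) (map (_∷ w) (alphabet n))
    extend (len , inRange) = All.map⁺ (All.map (λ a∈ → cong suc len , a∈ ∷ inRange) (alphabet-InRange n))

  distinct⇒Unique : ∀ w → T (distinct w) → Unique w
  distinct⇒Unique []      _ = []
  distinct⇒Unique (x ∷ w) d with any (λ y → x ≡ᵇ y) w in x∈?w
  ... | false = All.map (λ x≢ᵇy x≡y → x≢ᵇy (ℕ.≡⇒≡ᵇ x _ x≡y)) (All.¬Any⇒All¬ w (λ x∈w → subst T x∈?w (any⁺ _ x∈w)))
                ∷ distinct⇒Unique w d

  Unique⇒distinct : ∀ w → Unique w → T (distinct w)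
  Unique⇒distinct []      _            = tt
  Unique⇒distinct (x ∷ w) (x∉w ∷ !w) with any (λ y → x ≡ᵇ y) w in x∈?w
  ... | false = Unique⇒distinct w !w
  ... | true  = ⊥-elim (All.All¬⇒¬Any (All.map (λ x≢y x≡ᵇy → x≢y (ℕ.≡ᵇ⇒≡ x _ x≡ᵇy)) x∉w)
                                        (any⁻ _ w (subst T (sym x∈?w) tt)))

  perms-IsPerm : ∀ n → All (IsPerm n) (perms n)
  perms-IsPerm n =
    All.map (λ {π} ((len , inRange) , d) → len , inRange , distinct⇒Unique π d)
            (All.zip (All.filter⁺ (T? ∘ distinct) (words-shape n n) , All.all-filter (T? ∘ distinct) (words n n)))

  ∈-delete : ∀ {y x : ℕ} a c → y ∈ a ++ x ∷ c → y ≢ x → y ∈ a ++ c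
  ∈-delete []      c (here refl)  y≢x = ⊥-elim (y≢x refl)
  ∈-delete []      c (there y∈c)  _   = y∈c
  ∈-delete (z ∷ a) c (here y≡z)   _   = here y≡z
  ∈-delete (z ∷ a) c (there y∈ac) y≢x = there (∈-delete a c y∈ac y≢x)

  pigeonhole : ∀ (w L : List ℕ) → Unique w → All (_∈ L) w → length w ≤ length L
  pigeonhole []      L _            _          = z≤n
  pigeonhole (x ∷ w) L (x∉w ∷ !w) (x∈L ∷ w⊆L) with ∈.∈-∃++ x∈L
  ... | a , c , refl =
    subst (suc (length w) ≤_) (sym (length-insert a c x))
          (s≤s (pigeonhole w (a ++ c) !w (All.zipWith (λ (x≢y , y∈) → ∈-delete a c y∈ (λ y≡x → x≢y (sym y≡x))) (x∉w , w⊆L))))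

  IsPerm-∈ : ∀ n π → IsPerm n π → ∀ {v} → InRange n v → v ∈ π
  IsPerm-∈ n π (len , inRange , !π) {v} v∈ with v ∈? π
  ... | yes v∈π = v∈π
  ... | no  v∉π with ∈.∈-∃++ (InRange⇒∈alphabet n v∈)
  ...   | a , c , alphabet≡ = ⊥-elim (ℕ.<-irrefl refl (subst (_≤ length (a ++ c)) len≡ (pigeonhole π (a ++ c) !π π⊆)))
    where
    π⊆ : All (_∈ a ++ c) π
    π⊆ = All.tabulate λ {y} y∈π →
      ∈-delete a c (subst (y ∈_) alphabet≡ (InRange⇒∈alphabet n (All.lookup inRange y∈π))) (λ y≡v → v∉π (subst (_∈ π) y≡v y∈π))
    len≡ : length π ≡ suc (length (a ++ c))
    len≡ = trans len (trans (sym (trans (length-map suc (upTo n)) (length-upTo n))) (trans (cong length alphabet≡) (length-insert a c v)))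

  occurrences-words : ∀ n k w → length w ≡ k → All (InRange n) w → occurrences (_≟ᴺ_) w (words n k) ≡ 1
  occurrences-words n zero    []      _   _                = refl
  occurrences-words n (suc k) (x ∷ w) len (x∈ ∷ inRange) =
    trans (extend (words n k)) (occurrences-words n k w (ℕ.suc-injective len) inRange)
    where
    extend : ∀ W → occurrences (_≟ᴺ_) (x ∷ w) (concatMap (λ u → map (_∷ u) (alphabet n)) W)
                   ≡ occurrences (_≟ᴺ_) w W
    extend []      = refl
    extend (u ∷ W) = begin
      occurrences (_≟ᴺ_) (x ∷ w) (map (_∷ u) (alphabet n) ++ _)
        ≡⟨ occurrences-++ (_≟ᴺ_) (x ∷ w) (map (_∷ u) (alphabet n)) _ ⟩
      occurrences (_≟ᴺ_) (x ∷ w) (map (_∷ u) (alphabet n)) + _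
        ≡⟨ cong₂ _+_ (occurrences-map-∷ʳ _≟_ x w u (alphabet n)) (extend W) ⟩
      occurrences _≟_ x (alphabet n) * one? (does (_≟ᴺ_ w u)) + occurrences (_≟ᴺ_) w W
        ≡⟨ cong (λ k → k * _ + _) (occurrences-Unique _≟_ x (alphabet n) (alphabet-Unique n) (InRange⇒∈alphabet n x∈)) ⟩
      1 * one? (does (_≟ᴺ_ w u)) + occurrences (_≟ᴺ_) w W
        ≡⟨ cong (_+ occurrences (_≟ᴺ_) w W) (ℕ.*-identityˡ (one? (does (_≟ᴺ_ w u)))) ⟩
      occurrences (_≟ᴺ_) w (u ∷ W) ∎
      where open ≡-Reasoning

  occurrences-perms : ∀ n w → IsPerm n w → occurrences (_≟ᴺ_) w (perms n) ≡ 1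
  occurrences-perms n w (len , inRange , !w) =
    trans (occurrences-filter (_≟ᴺ_) (T? ∘ distinct) (Unique⇒distinct w !w) (words n n))
          (occurrences-words n n w len inRange)

  all-isBelow≡all-isValue : ∀ v pre → All (_< v) (values pre) → all (isBelow v) pre ≡ all isValue pre
  all-isBelow≡all-isValue v []            _             = refl
  all-isBelow≡all-isValue v (gap ∷ pre)   _             = refl
  all-isBelow≡all-isValue v (val u ∷ pre) (u<v ∷ pre<v) =
    cong₂ _∧_ (dec-true (u <? v) u<v) (all-isBelow≡all-isValue v pre pre<v)

  all-isAbove≡null : ∀ v g → NoAdjacentGaps (gap ∷ g) → All (_< v) (values g) → all (isAbove v) g ≡ null g
  all-isAbove≡null v []          _ _         = refl
  all-isAbove≡null v (val u ∷ g) _ (u<v ∷ _) = cong (_∧ all (isAbove v) g) (dec-false (v <? u) (ℕ.<⇒≯ u<v))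

  insertions-all-isAbove : ∀ u v g → u < v → All (_< v) (values g) →
                           All (λ h → all (isAbove u) h ≡ all (isAbove u) g) (insertions v g)
  insertions-all-isAbove u v []          u<v _             = []
  insertions-all-isAbove u v (gap ∷ g)   u<v g<v =
    cong (_∧ rest) u<ᵇv ∷ cong (_∧ rest) u<ᵇv ∷ cong (_∧ rest) u<ᵇv ∷ cong (_∧ rest) u<ᵇv
    ∷ All.map⁺ (insertions-all-isAbove u v g u<v g<v)
    where
    rest = all (isAbove u) g
    u<ᵇv : (u <ᵇ v) ≡ true
    u<ᵇv = dec-true (u <? v) u<v
  insertions-all-isAbove u v (val x ∷ g) u<v (_ ∷ g<v) =
    All.map⁺ (All.map (cong ((u <ᵇ x) ∧_)) (insertions-all-isAbove u v g u<v g<v))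

  Blocks : ℕ → Word → Set
  Blocks v pre = ∀ {u} → u < v → all (isBelow u) pre ≡ false

  Blocks-last : ∀ {v} pre t → (∀ {u} → u < v → isBelow u t ≡ false) → Blocks v (pre ++ [ t ])
  Blocks-last pre t t-blocks u<v =
    trans (all-++ (isBelow _) pre [ t ]) (trans (cong (λ b → all (isBelow _) pre ∧ (b ∧ true)) (t-blocks u<v)) (∧-zeroʳ _))

  Blocks-snoc : ∀ {v} pre t → Blocks v pre → Blocks v (pre ++ [ t ])
  Blocks-snoc pre t pre-blocks u<v = trans (all-++ (isBelow _) pre [ t ]) (cong (_∧ _) (pre-blocks u<v))

  Blocks-gap : ∀ {v} pre → Blocks v (pre ++ [ gap ])
  Blocks-gap pre = Blocks-last pre gap (λ _ → refl)

  Blocks-val : ∀ {v} pre → Blocks v (pre ++ [ val v ])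
  Blocks-val pre = Blocks-last pre (val _) (λ u<v → dec-false (_ <? _) (ℕ.<⇒≯ u<v))

  values-map-val : ∀ π → values (map val π) ≡ π
  values-map-val []      = refl
  values-map-val (u ∷ π) = cong (u ∷_) (values-map-val π)

  gapCount-map-val : ∀ π → gapCount (map val π) ≡ 0
  gapCount-map-val []      = refl
  gapCount-map-val (u ∷ π) = gapCount-map-val π

  NoAdjacentGaps-map-val : ∀ π → NoAdjacentGaps (map val π)
  NoAdjacentGaps-map-val []      = tt
  NoAdjacentGaps-map-val (u ∷ π) = NoAdjacentGaps-map-val π

  gapless⇒map-val : ∀ g → gapCount g ≡ 0 → g ≡ map val (values g)
  gapless⇒map-val []          _ = refl
  gapless⇒map-val (val u ∷ g) n = cong (val u ∷_) (gapless⇒map-val g n)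

  squash-map-val : ∀ n π → All (InRange n) π → squash n (map val π) ≡ map val π
  squash-map-val n π inRange =
    squash-id n (map val π) (NoAdjacentGaps-map-val π)
              (subst (All (_< suc n)) (sym (values-map-val π)) (All.map (λ (_ , u≤n) → s≤s u≤n) inRange))

  does-≟-map-val : ∀ π w → does (map val π ≟ʷ map val w) ≡ does (_≟ᴺ_ π w)
  does-≟-map-val π w = Dec.does-⇔ (mk⇔ (map-injective val-injective) (cong (map val))) (map val π ≟ʷ map val w) (_≟ᴺ_ π w)

open Combinatorics

open import Data.Bool using (Bool; true; false; _∧_; not)
open import Data.Bool.Properties using (∧-identityʳ; ∧-zeroʳ)
open import Data.Bool.ListAction using (all; and)
open import Data.List using (List; []; _∷_; _++_; [_]; map; null)
open import Data.List.Properties using (map-∘; map-++; ++-assoc; ≡-dec)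
open import Data.List.Relation.Unary.All using (All; []; _∷_)
import Data.List.Relation.Unary.All as All
import Data.List.Relation.Unary.AllPairs as AllPairs
open import Data.Nat using (ℕ; zero; suc; _∸_; _≤_; _<_; _<ᵇ_; z≤n; s≤s)
import Data.Nat as ℕ
import Data.Nat.Properties as ℕ
open import Data.Product using (_,_; proj₁; proj₂)
open import Data.Unit using (tt)
open import Relation.Binary.Definitions using (DecidableEquality)
import Relation.Binary.PropositionalEquality as ≡
open ≡ using (_≡_)
open import Relation.Nullary using (does; yes; no)
import Relation.Nullary.Decidable as Dec

module _ {c ℓ : Level} (R : CommutativeRing c ℓ) where

  open CommutativeRing R
  open OverRing R
  open import Algebra.Properties.Ring ring using (-‿distribˡ-*)
  open import Algebra.Properties.Group +-group using (//-rightDividesˡ)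
  open import Algebra.Solver.Ring.NaturalCoefficients.Default commutativeSemiring
  open import Relation.Binary.Reasoning.Setoid setoid

  ∑ : ∀ {A : Set} → (A → Carrier) → List A → Carrier
  ∑ f []      = 0#
  ∑ f (x ∷ L) = f x + ∑ f L

  sumR-map : ∀ {A : Set} (f : A → Carrier) L → sumR (map f L) ≡ ∑ f L
  sumR-map f []      = ≡.refl
  sumR-map f (x ∷ L) = ≡.cong (f x +_) (sumR-map f L)

  ∑-map : ∀ {A B : Set} (f : B → Carrier) (g : A → B) L → ∑ f (map g L) ≡ ∑ (λ x → f (g x)) L
  ∑-map f g []      = ≡.refl
  ∑-map f g (x ∷ L) = ≡.cong (f (g x) +_) (∑-map f g L)

  ∑-congᴬ : ∀ {A : Set} {f g : A → Carrier} L → All (λ x → f x ≈ g x) L → ∑ f L ≈ ∑ g L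
  ∑-congᴬ []      []           = refl
  ∑-congᴬ (x ∷ L) (fx≈gx ∷ f≈g) = +-cong fx≈gx (∑-congᴬ L f≈g)

  ∑-cong : ∀ {A : Set} {f g : A → Carrier} L → (∀ x → f x ≈ g x) → ∑ f L ≈ ∑ g L
  ∑-cong L f≈g = ∑-congᴬ L (All.tabulate λ {x} _ → f≈g x)

  ∑-*ˡ : ∀ {A : Set} a (f : A → Carrier) L → ∑ (λ x → a * f x) L ≈ a * ∑ f L
  ∑-*ˡ a f []      = sym (zeroʳ a)
  ∑-*ˡ a f (x ∷ L) = trans (+-cong refl (∑-*ˡ a f L)) (sym (distribˡ a _ _))

  ∑-*ʳ : ∀ {A : Set} a (f : A → Carrier) L → ∑ (λ x → f x * a) L ≈ ∑ f L * a
  ∑-*ʳ a f []      = sym (zeroˡ a)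
  ∑-*ʳ a f (x ∷ L) = trans (+-cong refl (∑-*ʳ a f L)) (sym (distribʳ a _ _))

  ∑-+ : ∀ {A : Set} (f g : A → Carrier) L → ∑ (λ x → f x + g x) L ≈ ∑ f L + ∑ g L
  ∑-+ f g []      = sym (+-identityˡ 0#)
  ∑-+ f g (x ∷ L) = trans (+-cong refl (∑-+ f g L))
    (solve 4 (λ a b c d → a :+ b :+ (c :+ d) := (a :+ c) :+ (b :+ d)) refl (f x) (g x) (∑ f L) (∑ g L))

  ∑-zero : ∀ {A : Set} (L : List A) → ∑ (λ _ → 0#) L ≈ 0#
  ∑-zero []      = refl
  ∑-zero (x ∷ L) = trans (+-identityˡ _) (∑-zero L)

  ∑-swap : ∀ {A B : Set} (f : A → B → Carrier) L M → ∑ (λ x → ∑ (f x) M) L ≈ ∑ (λ y → ∑ (λ x → f x y) L) M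
  ∑-swap f []      M = sym (∑-zero M)
  ∑-swap f (x ∷ L) M = trans (+-cong refl (∑-swap f L M)) (sym (∑-+ (f x) (λ y → ∑ (λ x′ → f x′ y) L) M))

  nat-+ : ∀ a b → nat (a ℕ.+ b) ≈ nat a + nat b
  nat-+ zero    b = sym (+-identityˡ _)
  nat-+ (suc a) b = trans (+-cong refl (nat-+ a b)) (sym (+-assoc _ _ _))

  indicator : Bool → Carrier
  indicator true  = 1#
  indicator false = 0#

  nat-one? : ∀ b → nat (one? b) ≈ indicator b
  nat-one? true  = +-identityʳ 1#
  nat-one? false = refl

  ∑-indicator : ∀ {A : Set} (_≟_ : DecidableEquality A) x L →
                ∑ (λ y → indicator (does (x ≟ y))) L ≈ nat (occurrences _≟_ x L)
  ∑-indicator _≟_ x []      = refl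
  ∑-indicator _≟_ x (y ∷ L) =
    trans (+-cong (sym (nat-one? (does (x ≟ y)))) (∑-indicator _≟_ x L)) (sym (nat-+ (one? (does (x ≟ y))) _))

  -- Moments as weighted Motzkin paths

  module _ (m : ℕ → Carrier) where

    applyFrom-xMul : ∀ n f → applyFrom m n (xMul f) ≈ applyFrom m (suc n) f
    applyFrom-xMul n f = trans (+-cong (zeroˡ (m n)) refl) (+-identityˡ _)

    applyFrom-⊕ : ∀ n f g → applyFrom m n (f ⊕ g) ≈ applyFrom m n f + applyFrom m n g
    applyFrom-⊕ n []      g       = sym (+-identityˡ _)
    applyFrom-⊕ n (a ∷ f) []      = sym (+-identityʳ _)
    applyFrom-⊕ n (a ∷ f) (b ∷ g) = begin
      (a + b) * m n + applyFrom m (suc n) (f ⊕ g)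
        ≈⟨ +-cong refl (applyFrom-⊕ (suc n) f g) ⟩
      (a + b) * m n + (applyFrom m (suc n) f + applyFrom m (suc n) g)
        ≈⟨ solve 5 (λ a b mₙ u v → (a :+ b) :* mₙ :+ (u :+ v) := (a :* mₙ :+ u) :+ (b :* mₙ :+ v))
                 refl a b (m n) (applyFrom m (suc n) f) (applyFrom m (suc n) g) ⟩
      (a * m n + applyFrom m (suc n) f) + (b * m n + applyFrom m (suc n) g) ∎

    applyFrom-⊛ : ∀ n r f → applyFrom m n (r ⊛ f) ≈ r * applyFrom m n f
    applyFrom-⊛ n r []      = sym (zeroʳ r)
    applyFrom-⊛ n r (a ∷ f) = begin
      r * a * m n + applyFrom m (suc n) (r ⊛ f) ≈⟨ +-cong refl (applyFrom-⊛ (suc n) r f) ⟩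
      r * a * m n + r * applyFrom m (suc n) f    ≈⟨ solve 4 (λ r a mₙ u → r :* a :* mₙ :+ r :* u := r :* (a :* mₙ :+ u))
                                                           refl r a (m n) (applyFrom m (suc n) f) ⟩
      r * (a * m n + applyFrom m (suc n) f)      ∎

  move-negations : ∀ x y u v → x ≈ (y + - u) + - v → y ≈ (x + u) + v
  move-negations x y u v x≈ = sym (begin
    (x + u) + v                         ≈⟨ +-cong (+-cong x≈ refl) refl ⟩
    (((y + - u) + - v) + u) + v         ≈⟨ +-cong (solve 3 (λ a b c → (a :+ b) :+ c := (a :+ c) :+ b) refl (y + - u) (- v) u) refl ⟩
    (((y + - u) + u) + - v) + v         ≈⟨ //-rightDividesˡ v _ ⟩
    (y + - u) + u                       ≈⟨ //-rightDividesˡ u y ⟩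
    y                                   ∎)

  module _ (X Y : Carrier) where

    open Seq X Y

    previous : ℕ → Poly
    previous k = proj₁ (pair k)

    applyFrom-three-term : ∀ m n k →
      applyFrom m (suc n) (p k) ≈ (applyFrom m n (p (suc k)) + b k * applyFrom m n (p k)) + lam k * applyFrom m n (previous k)
    applyFrom-three-term m n k = move-negations _ _ _ _ (begin
      A n (p (suc k))
        ≈⟨ applyFrom-⊕ m n (xMul (p k) ⊕ ((- b k) ⊛ p k)) ((- lam k) ⊛ previous k) ⟩
      A n (xMul (p k) ⊕ ((- b k) ⊛ p k)) + A n ((- lam k) ⊛ previous k)
        ≈⟨ +-cong (applyFrom-⊕ m n (xMul (p k)) ((- b k) ⊛ p k)) (applyFrom-⊛ m n (- lam k) (previous k)) ⟩
      (A n (xMul (p k)) + A n ((- b k) ⊛ p k)) + (- lam k) * A n (previous k)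
        ≈⟨ +-cong (+-cong (applyFrom-xMul m n (p k)) (applyFrom-⊛ m n (- b k) (p k))) (sym (-‿distribˡ-* _ _)) ⟩
      (A (suc n) (p k) + (- b k) * A n (p k)) + - (lam k * A n (previous k))
        ≈⟨ +-cong (+-cong refl (sym (-‿distribˡ-* _ _))) refl ⟩
      (A (suc n) (p k) + - (b k * A n (p k))) + - (lam k * A n (previous k)) ∎)
      where
      A = applyFrom m

    risingX : ℕ → Carrier
    risingX zero    = 1#
    risingX (suc k) = risingX k * (nat (suc k) + X)

    downStep : (ℕ → Carrier) → ℕ → Carrier
    downStep f zero    = 0#
    downStep f (suc k) = (nat k + Y) * f k

    -- Weighted Motzkin paths of length n from height k to height 0: λₖ₊₁ is split
    -- into the up step k → k+1 (weight k+1+X) and the down step k+1 → k (weight k+Y).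
    pathSum : ℕ → ℕ → Carrier
    pathSum zero    zero    = 1#
    pathSum zero    (suc k) = 0#
    pathSum (suc n) k = ((nat (suc k) + X) * pathSum n (suc k) + b k * pathSum n k) + downStep (pathSum n) k

    module _ (m : ℕ → Carrier) (𝓛1≈1 : 𝓛 m (1# ∷ []) ≈ 1#) (𝓛p≈0 : ∀ k → 𝓛 m (p (suc k)) ≈ 0#) where

      applyFrom-p : ∀ n k → applyFrom m n (p k) ≈ risingX k * pathSum n k
      applyFrom-p zero    zero    = trans 𝓛1≈1 (sym (*-identityˡ 1#))
      applyFrom-p zero    (suc k) = trans (𝓛p≈0 k) (sym (zeroʳ _))
      applyFrom-p (suc n) zero    = begin
        applyFrom m (suc n) (p 0)
          ≈⟨ applyFrom-three-term m n 0 ⟩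
        (applyFrom m n (p 1) + b 0 * applyFrom m n (p 0)) + lam 0 * 0#
          ≈⟨ +-cong (+-cong (applyFrom-p n 1) (*-cong refl (applyFrom-p n 0))) refl ⟩
        (risingX 1 * pathSum n 1 + b 0 * (risingX 0 * pathSum n 0)) + 0# * 0#
          ≈⟨ solve 4 (λ x d₁ b₀ d₀ → ((con 1 :* ((con 1 :+ con 0) :+ x)) :* d₁ :+ b₀ :* (con 1 :* d₀)) :+ con 0 :* con 0
                                   := con 1 :* ((((con 1 :+ con 0) :+ x) :* d₁ :+ b₀ :* d₀) :+ con 0))
                   refl X (pathSum n 1) (b 0) (pathSum n 0) ⟩
        risingX 0 * pathSum (suc n) 0 ∎
      applyFrom-p (suc n) (suc k) = begin
        applyFrom m (suc n) (p (suc k))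
          ≈⟨ applyFrom-three-term m n (suc k) ⟩
        (applyFrom m n (p (2 ℕ.+ k)) + b (suc k) * applyFrom m n (p (suc k))) + lam (suc k) * applyFrom m n (p k)
          ≈⟨ +-cong (+-cong (applyFrom-p n (2 ℕ.+ k)) (*-cong refl (applyFrom-p n (suc k)))) (*-cong refl (applyFrom-p n k)) ⟩
        (risingX (2 ℕ.+ k) * pathSum n (2 ℕ.+ k) + b (suc k) * (risingX (suc k) * pathSum n (suc k))) + lam (suc k) * (risingX k * pathSum n k)
          ≈⟨ solve 8 (λ r u u′ d₂ bb d₁ w d₀ → ((r :* u) :* u′ :* d₂ :+ bb :* ((r :* u) :* d₁)) :+ (u :* w) :* (r :* d₀)
                                             := (r :* u) :* ((u′ :* d₂ :+ bb :* d₁) :+ w :* d₀))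
                   refl (risingX k) (nat (suc k) + X) (nat (2 ℕ.+ k) + X) (pathSum n (2 ℕ.+ k))
                        (b (suc k)) (pathSum n (suc k)) (nat k + Y) (pathSum n k) ⟩
        risingX (suc k) * pathSum (suc n) (suc k) ∎

      moment≈pathSum : ∀ n → m n ≈ pathSum n 0
      moment≈pathSum n = begin
        m n                  ≈⟨ sym (trans (+-identityʳ _) (*-identityˡ _)) ⟩
        1# * m n + 0#        ≈⟨ applyFrom-p n 0 ⟩
        1# * pathSum n 0     ≈⟨ *-identityˡ _ ⟩
        pathSum n 0          ∎

    -- Permutation weights as products over entries

    -- arguments: the entry is a left-to-right maximum, a right-to-left minimum
    weight : Bool → Bool → Carrier
    weight true  true  = X + Y
    weight true  false = Y
    weight false true  = X + 1#
    weight false false = 1#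

    -- the first argument holds the letters to the left
    wordWeight : Word → Word → Carrier
    wordWeight pre []          = 1#
    wordWeight pre (gap ∷ t)   = wordWeight (pre ++ [ gap ]) t
    wordWeight pre (val u ∷ t) = weight (all (isBelow u) pre) (all (isAbove u) t) * wordWeight (pre ++ [ val u ]) t

    monomial : ℕ → ℕ → ℕ → Carrier
    monomial r q l = (pow (X + 1#) (r ∸ q) * pow (X + Y) q) * pow Y (l ∸ q)

    one?-∧≤ʳ : ∀ a b → one? (a ∧ b) ≤ one? b
    one?-∧≤ʳ true  b = ℕ.≤-refl
    one?-∧≤ʳ false b = z≤n

    one?-∧≤ˡ : ∀ a b → one? (a ∧ b) ≤ one? a
    one?-∧≤ˡ true  true  = ℕ.≤-refl
    one?-∧≤ˡ true  false = z≤n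
    one?-∧≤ˡ false b     = z≤n

    pivotFrom≤RLmin : ∀ pre xs → pivotFrom pre xs ≤ RLmin xs
    pivotFrom≤RLmin pre []       = z≤n
    pivotFrom≤RLmin pre (x ∷ xs) = ℕ.+-mono-≤ (one?-∧≤ʳ (all (_<ᵇ x) pre) _) (pivotFrom≤RLmin (pre ++ [ x ]) xs)

    pivotFrom≤LRmaxFrom : ∀ pre xs → pivotFrom pre xs ≤ LRmaxFrom pre xs
    pivotFrom≤LRmaxFrom pre []       = z≤n
    pivotFrom≤LRmaxFrom pre (x ∷ xs) = ℕ.+-mono-≤ (one?-∧≤ˡ (all (_<ᵇ x) pre) _) (pivotFrom≤LRmaxFrom (pre ++ [ x ]) xs)

    pow-suc-∸ : ∀ z {r q} → q ≤ r → pow z (suc r ∸ q) ≈ z * pow z (r ∸ q)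
    pow-suc-∸ z q≤r = reflexive (≡.cong (pow z) (ℕ.+-∸-assoc 1 q≤r))

    monomial-step : ∀ a b r q l → q ≤ r → q ≤ l →
      monomial (one? b ℕ.+ r) (one? (a ∧ b) ℕ.+ q) (one? a ℕ.+ l) ≈ weight a b * monomial r q l
    monomial-step true  true  r q l _   _   =
      solve 4 (λ u v z w → (u :* (z :* v)) :* w := z :* ((u :* v) :* w)) refl (pow (X + 1#) (r ∸ q)) (pow (X + Y) q) (X + Y) (pow Y (l ∸ q))
    monomial-step true  false r q l _   q≤l = trans (*-cong refl (pow-suc-∸ Y q≤l))
      (solve 4 (λ u v z w → (u :* v) :* (z :* w) := z :* ((u :* v) :* w)) refl (pow (X + 1#) (r ∸ q)) (pow (X + Y) q) Y (pow Y (l ∸ q)))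
    monomial-step false true  r q l q≤r _   = trans (*-cong (*-cong (pow-suc-∸ (X + 1#) q≤r) refl) refl)
      (solve 4 (λ z u v w → ((z :* u) :* v) :* w := z :* ((u :* v) :* w)) refl (X + 1#) (pow (X + 1#) (r ∸ q)) (pow (X + Y) q) (pow Y (l ∸ q)))
    monomial-step false false r q l _   _   = sym (*-identityˡ _)

    all-map-val : ∀ (f : Letter → Bool) xs → all f (map val xs) ≡ all (λ x → f (val x)) xs
    all-map-val f xs = ≡.cong and (≡.sym (map-∘ xs))

    monomial≈wordWeight : ∀ pre xs →
      monomial (RLmin xs) (pivotFrom pre xs) (LRmaxFrom pre xs) ≈ wordWeight (map val pre) (map val xs)
    monomial≈wordWeight pre []       = trans (*-identityʳ _) (*-identityʳ _)
    monomial≈wordWeight pre (x ∷ xs) = begin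
      monomial (RLmin (x ∷ xs)) (pivotFrom pre (x ∷ xs)) (LRmaxFrom pre (x ∷ xs))
        ≈⟨ monomial-step (all (_<ᵇ x) pre) (all (x <ᵇ_) xs) (RLmin xs) (pivotFrom pre′ xs) (LRmaxFrom pre′ xs)
                         (pivotFrom≤RLmin pre′ xs) (pivotFrom≤LRmaxFrom pre′ xs) ⟩
      weight (all (_<ᵇ x) pre) (all (x <ᵇ_) xs) * monomial (RLmin xs) (pivotFrom pre′ xs) (LRmaxFrom pre′ xs)
        ≈⟨ *-cong (reflexive (≡.sym (≡.cong₂ weight (all-map-val (isBelow x) pre) (all-map-val (isAbove x) xs))))
                  (trans (monomial≈wordWeight pre′ xs) (reflexive (≡.cong (λ p′ → wordWeight p′ (map val xs)) (map-++ val pre [ x ])))) ⟩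
      wordWeight (map val pre) (map val (x ∷ xs)) ∎
      where
      pre′ = pre ++ [ x ]

    -- Completing a word with gaps

    -- Filling one gap of a word with r gaps (e: it ends with a gap) by v, v□, □v or □v□;
    -- `first`: only values precede the gap, `last`: the gap ends the word.
    gapFill : (ℕ → Bool → Carrier) → ℕ → Bool → Bool → Bool → Carrier
    gapFill f r e first last =
      ((weight first last * f (ℕ.pred r) (e ∧ not last) + weight first last * f r e)
        + weight false last * f r (e ∧ not last)) + weight false last * f (suc r) e

    gapSum : (ℕ → Bool → Carrier) → ℕ → Bool → Bool → Word → Carrier
    gapSum f r e first []          = 0#
    gapSum f r e first (gap ∷ g)   = gapFill f r e first (null g) + gapSum f r e false g
    gapSum f r e first (val u ∷ g) = gapSum f r e first g

    -- gapSum f r e false g and gapSum f r e true g in terms of the number j of gaps of g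
    -- and whether g ends with a gap
    laterGapsFill : (ℕ → Bool → Carrier) → ℕ → Bool → ℕ → Bool → Carrier
    laterGapsFill f r e zero    eg = 0#
    laterGapsFill f r e (suc j) eg = nat j * gapFill f r e false false + gapFill f r e false eg

    allGapsFill : (ℕ → Bool → Carrier) → ℕ → Bool → ℕ → Bool → Carrier
    allGapsFill f r e zero          eg = 0#
    allGapsFill f r e (suc zero)    eg = gapFill f r e true eg
    allGapsFill f r e (suc (suc j)) eg = (gapFill f r e true false + nat j * gapFill f r e false false) + gapFill f r e false eg

    -- Total weight gained by k further insertions into a word with r gaps
    -- (e: it ends with a gap).
    completion : ℕ → ℕ → Bool → Carrier
    completion zero    zero    e = 1#
    completion zero    (suc r) e = 0#
    completion (suc k) r       e = allGapsFill (completion k) r e r e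

    b≈2k+X+Y : ∀ k → b k ≈ ((nat k + nat k) + X) + Y
    b≈2k+X+Y k = +-cong (+-cong (trans (nat-+ k (k ℕ.+ 0)) (+-cong refl (reflexive (≡.cong nat (ℕ.+-identityʳ k))))) refl) refl

    completion≈pathSum : ∀ k r → completion k (suc r) true + completion k r false ≈ pathSum k r
    completion≈pathSum zero    zero    = +-identityˡ _
    completion≈pathSum zero    (suc r) = +-identityˡ _
    completion≈pathSum (suc k) zero    = begin
      gapFill F 1 true true true + 0#
        ≈⟨ solve 6 (λ x y a b c d → ((((x :+ y) :* a :+ (x :+ y) :* b) :+ (x :+ con 1) :* c) :+ (x :+ con 1) :* d) :+ con 0
                 := (((con 1 :+ con 0) :+ x) :* (d :+ c) :+ ((con 0 :+ x) :+ y) :* (b :+ a)) :+ con 0)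
                 refl X Y (F 0 false) (F 1 true) (F 1 false) (F 2 true) ⟩
      ((nat 1 + X) * (F 2 true + F 1 false) + b 0 * (F 1 true + F 0 false)) + 0#
        ≈⟨ +-cong (+-cong (*-cong refl (completion≈pathSum k 1)) (*-cong refl (completion≈pathSum k 0))) refl ⟩
      pathSum (suc k) 0 ∎
      where
      F = completion k
    completion≈pathSum (suc k) (suc zero) = begin
      completion (suc k) 2 true + completion (suc k) 1 false
        ≈⟨ solve 8 (λ x y a b c d e g →
             (((((y :* a :+ y :* b) :+ con 1 :* b) :+ con 1 :* c) :+ con 0 :* (((con 1 :* a :+ con 1 :* b) :+ con 1 :* b) :+ con 1 :* c))
               :+ ((((x :+ con 1) :* e :+ (x :+ con 1) :* b) :+ (x :+ con 1) :* g) :+ (x :+ con 1) :* c))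
             :+ (((y :* d :+ y :* e) :+ con 1 :* e) :+ con 1 :* g)
             := (((con 1 :+ (con 1 :+ con 0)) :+ x) :* (c :+ g) :+ ((((con 1 :+ (con 1 :+ con 0)) :+ x) :+ y) :* (b :+ e))) :+ (con 0 :+ y) :* (a :+ d))
             refl X Y (F 1 true) (F 2 true) (F 3 true) (F 0 false) (F 1 false) (F 2 false) ⟩
      ((nat 2 + X) * (F 3 true + F 2 false) + b 1 * (F 2 true + F 1 false)) + (nat 0 + Y) * (F 1 true + F 0 false)
        ≈⟨ +-cong (+-cong (*-cong refl (completion≈pathSum k 2)) (*-cong refl (completion≈pathSum k 1))) (*-cong refl (completion≈pathSum k 0)) ⟩
      pathSum (suc k) 1 ∎
      where
      F = completion k
    completion≈pathSum (suc k) (suc (suc r)) = begin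
      completion (suc k) (3 ℕ.+ r) true + completion (suc k) (2 ℕ.+ r) false
        ≈⟨ solve 9 (λ x y n a b c d e g →
             ((((((y :* a :+ y :* b) :+ con 1 :* b) :+ con 1 :* c)
                :+ (con 1 :+ n) :* (((con 1 :* a :+ con 1 :* b) :+ con 1 :* b) :+ con 1 :* c))
               :+ ((((x :+ con 1) :* e :+ (x :+ con 1) :* b) :+ (x :+ con 1) :* g) :+ (x :+ con 1) :* c))
             :+ (((((y :* d :+ y :* e) :+ con 1 :* e) :+ con 1 :* g)
                :+ n :* (((con 1 :* d :+ con 1 :* e) :+ con 1 :* e) :+ con 1 :* g))
                :+ (((con 1 :* d :+ con 1 :* e) :+ con 1 :* e) :+ con 1 :* g)))
             := (((con 1 :+ (con 1 :+ (con 1 :+ n))) :+ x) :* (c :+ g)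
                  :+ (((((con 1 :+ (con 1 :+ n)) :+ (con 1 :+ (con 1 :+ n))) :+ x) :+ y) :* (b :+ e)))
                :+ ((con 1 :+ n) :+ y) :* (a :+ d))
             refl X Y (nat r) (F (2 ℕ.+ r) true) (F (3 ℕ.+ r) true) (F (4 ℕ.+ r) true)
                              (F (1 ℕ.+ r) false) (F (2 ℕ.+ r) false) (F (3 ℕ.+ r) false) ⟩
      ((nat (3 ℕ.+ r) + X) * (F (4 ℕ.+ r) true + F (3 ℕ.+ r) false)
        + (((nat (2 ℕ.+ r) + nat (2 ℕ.+ r)) + X) + Y) * (F (3 ℕ.+ r) true + F (2 ℕ.+ r) false))
        + (nat (suc r) + Y) * (F (2 ℕ.+ r) true + F (1 ℕ.+ r) false)
        ≈⟨ +-cong (+-cong (*-cong refl (completion≈pathSum k (3 ℕ.+ r))) (*-cong (sym (b≈2k+X+Y (2 ℕ.+ r))) (completion≈pathSum k (2 ℕ.+ r))))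
                  (*-cong refl (completion≈pathSum k (suc r))) ⟩
      pathSum (suc k) (suc (suc r)) ∎
      where
      F = completion k

    gapSum-later : ∀ f r e g → gapSum f r e false g ≈ laterGapsFill f r e (gapCount g) (endsWithGap g)
    gapSum-later f r e []              = refl
    gapSum-later f r e (val u ∷ [])    = refl
    gapSum-later f r e (val u ∷ t ∷ g) = gapSum-later f r e (t ∷ g)
    gapSum-later f r e (gap ∷ g) with tailShape g | gapSum-later f r e g
    ... | gapless n en | ih = begin
      fill (null g) + gapSum f r e false g
        ≈⟨ +-cong refl (trans ih (reflexive (≡.cong (λ j → laterGapsFill f r e j (endsWithGap g)) n))) ⟩
      fill (null g) + 0#
        ≈⟨ solve 2 (λ a b → a :+ con 0 := con 0 :* b :+ a) refl (fill (null g)) (fill false) ⟩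
      nat 0 * fill false + fill (null g)
        ≈⟨ reflexive (≡.cong₂ (λ j eg → laterGapsFill f r e (suc j) eg) (≡.sym n) (≡.sym en)) ⟩
      laterGapsFill f r e (gapCount (gap ∷ g)) (endsWithGap (gap ∷ g)) ∎
      where
      fill = gapFill f r e false
    ... | gapped j n nonempty en | ih = begin
      fill (null g) + gapSum f r e false g
        ≈⟨ +-cong (reflexive (≡.cong fill nonempty)) (trans ih (reflexive (≡.cong (λ j → laterGapsFill f r e j (endsWithGap g)) n))) ⟩
      fill false + (nat j * fill false + fill (endsWithGap g))
        ≈⟨ solve 3 (λ a nⱼ b → a :+ (nⱼ :* a :+ b) := (con 1 :+ nⱼ) :* a :+ b) refl (fill false) (nat j) (fill (endsWithGap g)) ⟩
      nat (suc j) * fill false + fill (endsWithGap g)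
        ≈⟨ reflexive (≡.cong₂ (λ j eg → laterGapsFill f r e (suc j) eg) (≡.sym n) (≡.sym en)) ⟩
      laterGapsFill f r e (gapCount (gap ∷ g)) (endsWithGap (gap ∷ g)) ∎
      where
      fill = gapFill f r e false

    gapSum-first : ∀ f r e g → gapSum f r e true g ≈ allGapsFill f r e (gapCount g) (endsWithGap g)
    gapSum-first f r e []              = refl
    gapSum-first f r e (val u ∷ [])    = refl
    gapSum-first f r e (val u ∷ t ∷ g) = gapSum-first f r e (t ∷ g)
    gapSum-first f r e (gap ∷ g) with tailShape g | gapSum-later f r e g
    ... | gapless n en | later = begin
      gapFill f r e true (null g) + gapSum f r e false g
        ≈⟨ +-cong refl (trans later (reflexive (≡.cong (λ j → laterGapsFill f r e j (endsWithGap g)) n))) ⟩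
      gapFill f r e true (null g) + 0#
        ≈⟨ +-identityʳ _ ⟩
      gapFill f r e true (null g)
        ≈⟨ reflexive (≡.cong₂ (λ j eg → allGapsFill f r e (suc j) eg) (≡.sym n) (≡.sym en)) ⟩
      allGapsFill f r e (gapCount (gap ∷ g)) (endsWithGap (gap ∷ g)) ∎
    ... | gapped j n nonempty en | later = begin
      gapFill f r e true (null g) + gapSum f r e false g
        ≈⟨ +-cong (reflexive (≡.cong (gapFill f r e true) nonempty))
                  (trans later (reflexive (≡.cong (λ j → laterGapsFill f r e j (endsWithGap g)) n))) ⟩
      gapFill f r e true false + (nat j * gapFill f r e false false + gapFill f r e false (endsWithGap g))
        ≈⟨ sym (+-assoc _ _ _) ⟩
      (gapFill f r e true false + nat j * gapFill f r e false false) + gapFill f r e false (endsWithGap g)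
        ≈⟨ reflexive (≡.cong₂ (λ j eg → allGapsFill f r e (suc j) eg) (≡.sym n) (≡.sym en)) ⟩
      allGapsFill f r e (gapCount (gap ∷ g)) (endsWithGap (gap ∷ g)) ∎

    wordWeight-Blocks : ∀ {v} p₁ p₂ g → Blocks v p₁ → Blocks v p₂ → All (_< v) (values g) → wordWeight p₁ g ≈ wordWeight p₂ g
    wordWeight-Blocks p₁ p₂ []          _  _  _ = refl
    wordWeight-Blocks p₁ p₂ (gap ∷ g)   b₁ b₂ g<v =
      wordWeight-Blocks (p₁ ++ [ gap ]) (p₂ ++ [ gap ]) g (Blocks-snoc p₁ gap b₁) (Blocks-snoc p₂ gap b₂) g<v
    wordWeight-Blocks p₁ p₂ (val x ∷ g) b₁ b₂ (x<v ∷ g<v) =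
      *-cong (reflexive (≡.cong (λ a → weight a (all (isAbove x) g)) (≡.trans (b₁ x<v) (≡.sym (b₂ x<v)))))
             (wordWeight-Blocks (p₁ ++ [ val x ]) (p₂ ++ [ val x ]) g (Blocks-snoc p₁ (val x) b₁) (Blocks-snoc p₂ (val x) b₂) g<v)

    completionOf : ℕ → Word → Carrier
    completionOf k w = completion k (gapCount w) (endsWithGap w)

    weighted : ℕ → Word → Word → Carrier
    weighted k pre h = wordWeight pre h * completionOf k (pre ++ h)

    completionOf-++ : ∀ k pre x t → completionOf k (pre ++ x ∷ t) ≡ completion k (gapCount pre ℕ.+ gapCount (x ∷ t)) (endsWithGap (x ∷ t))
    completionOf-++ k pre x t = ≡.cong₂ (completion k) (gapCount-++ pre (x ∷ t)) (endsWithGap-++ pre x t)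

    completionOf-snoc : ∀ k pre x t → completionOf k (pre ++ x ∷ t) ≡ completionOf k ((pre ++ [ x ]) ++ t)
    completionOf-snoc k pre x t = ≡.cong (completionOf k) (≡.sym (++-assoc pre [ x ] t))

    weighted-fill : ∀ k v pre g r e → r ≡ gapCount pre ℕ.+ suc (gapCount g) → e ≡ endsWithGap (gap ∷ g) →
      All (_< v) (values pre) → All (_< v) (values g) → NoAdjacentGaps (gap ∷ g) →
      weighted k pre (val v ∷ g)
        + (weighted k pre (val v ∷ gap ∷ g) + (weighted k pre (gap ∷ val v ∷ g) + weighted k pre (gap ∷ val v ∷ gap ∷ g)))
      ≈ wordWeight (pre ++ [ gap ]) g * gapFill (completion k) r e (all isValue pre) (null g)
    weighted-fill k v pre g _ _ ≡.refl ≡.refl pre<v g<v na = begin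
      weighted k pre (val v ∷ g)
        + (weighted k pre (val v ∷ gap ∷ g) + (weighted k pre (gap ∷ val v ∷ g) + weighted k pre (gap ∷ val v ∷ gap ∷ g)))
        ≈⟨ +-cong fill-v (+-cong fill-v□ (+-cong fill-□v fill-□v□)) ⟩
      (wˡ * W) * F (ℕ.pred r) e′ + ((wˡ * W) * F r e + ((w⁰ * W) * F r e′ + (w⁰ * W) * F (suc r) e))
        ≈⟨ solve 7 (λ a b w f₁ f₂ f₃ f₄ → (a :* w) :* f₁ :+ ((a :* w) :* f₂ :+ ((b :* w) :* f₃ :+ (b :* w) :* f₄))
                                          := w :* (((a :* f₁ :+ a :* f₂) :+ b :* f₃) :+ b :* f₄))
                 refl wˡ w⁰ W (F (ℕ.pred r) e′) (F r e) (F r e′) (F (suc r) e) ⟩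
      W * gapFill F r e (all isValue pre) (null g) ∎
      where
      F = completion k
      W = wordWeight (pre ++ [ gap ]) g
      wˡ = weight (all isValue pre) (null g)
      w⁰ = weight false (null g)
      r = gapCount pre ℕ.+ suc (gapCount g)
      e = endsWithGap (gap ∷ g)
      e′ = e ∧ not (null g)
      below≡ : all (isBelow v) pre ≡ all isValue pre
      below≡ = all-isBelow≡all-isValue v pre pre<v
      gap-blocks : all (isBelow v) (pre ++ [ gap ]) ≡ false
      gap-blocks = Blocks-gap {suc v} pre (ℕ.n<1+n v)
      side : ∀ {c c′} p′ → c ≡ c′ → Blocks v p′ → weight c (all (isAbove v) g) * wordWeight p′ g ≈ weight c′ (null g) * W
      side p′ c≡ p′-blocks = *-cong (reflexive (≡.cong₂ weight c≡ (all-isAbove≡null v g na g<v)))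
                                    (wordWeight-Blocks p′ (pre ++ [ gap ]) g p′-blocks (Blocks-gap pre) g<v)
      fill-v : weighted k pre (val v ∷ g) ≈ (wˡ * W) * F (ℕ.pred r) e′
      fill-v = *-cong (side (pre ++ [ val v ]) below≡ (Blocks-val pre))
        (reflexive (≡.trans (completionOf-++ k pre (val v) g)
                            (≡.cong₂ F (≡.cong ℕ.pred (≡.sym (ℕ.+-suc (gapCount pre) (gapCount g)))) (endsWithGap-val∷ v g))))
      fill-v□ : weighted k pre (val v ∷ gap ∷ g) ≈ (wˡ * W) * F r e
      fill-v□ = *-cong (side ((pre ++ [ val v ]) ++ [ gap ]) below≡ (Blocks-gap (pre ++ [ val v ])))
        (reflexive (completionOf-++ k pre (val v) (gap ∷ g)))
      fill-□v : weighted k pre (gap ∷ val v ∷ g) ≈ (w⁰ * W) * F r e′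
      fill-□v = *-cong (side ((pre ++ [ gap ]) ++ [ val v ]) gap-blocks (Blocks-val (pre ++ [ gap ])))
        (reflexive (≡.trans (completionOf-++ k pre gap (val v ∷ g)) (≡.cong (F r) (endsWithGap-val∷ v g))))
      fill-□v□ : weighted k pre (gap ∷ val v ∷ gap ∷ g) ≈ (w⁰ * W) * F (suc r) e
      fill-□v□ = *-cong (side (((pre ++ [ gap ]) ++ [ val v ]) ++ [ gap ]) gap-blocks (Blocks-gap ((pre ++ [ gap ]) ++ [ val v ])))
        (reflexive (≡.trans (completionOf-++ k pre gap (val v ∷ gap ∷ g)) (≡.cong (λ j → F j e) (ℕ.+-suc (gapCount pre) (suc (gapCount g))))))

    all-isValue-snoc : ∀ pre t → all isValue (pre ++ [ t ]) ≡ all isValue pre ∧ isValue t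
    all-isValue-snoc pre t = ≡.trans (all-++ isValue pre [ t ]) (≡.cong (all isValue pre ∧_) (∧-identityʳ (isValue t)))

    weighted-gap∷ : ∀ k pre h → weighted k pre (gap ∷ h) ≈ weighted k (pre ++ [ gap ]) h
    weighted-gap∷ k pre h = *-cong refl (reflexive (completionOf-snoc k pre gap h))

    weighted-val∷ : ∀ k pre u h →
      weighted k pre (val u ∷ h) ≈ weight (all (isBelow u) pre) (all (isAbove u) h) * weighted k (pre ++ [ val u ]) h
    weighted-val∷ k pre u h = trans (*-cong refl (reflexive (completionOf-snoc k pre (val u) h))) (*-assoc _ _ _)

    ∑-insertions : ∀ k v pre g w → pre ++ g ≡ w →
      All (_< v) (values pre) → All (_< v) (values g) → NoAdjacentGaps g →
      ∑ (weighted k pre) (insertions v g) ≈ wordWeight pre g * gapSum (completion k) (gapCount w) (endsWithGap w) (all isValue pre) g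
    ∑-insertions k v pre [] w _ _ _ _ = sym (zeroʳ _)
    ∑-insertions k v pre (val u ∷ g) w pre++g≡w pre<v (u<v ∷ g<v) na = begin
      ∑ (weighted k pre) (map (val u ∷_) (insertions v g))
        ≡⟨ ∑-map (weighted k pre) (val u ∷_) (insertions v g) ⟩
      ∑ (λ h → weighted k pre (val u ∷ h)) (insertions v g)
        ≈⟨ ∑-congᴬ (insertions v g) (All.map (λ {h} → step h) (insertions-all-isAbove u v g u<v g<v)) ⟩
      ∑ (λ h → a * weighted k pre′ h) (insertions v g)
        ≈⟨ ∑-*ˡ a (weighted k pre′) (insertions v g) ⟩
      a * ∑ (weighted k pre′) (insertions v g)
        ≈⟨ *-cong refl (∑-insertions k v pre′ g w (≡.trans (++-assoc pre [ val u ] g) pre++g≡w)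
                                      (values-snoc< pre (val u) pre<v (u<v ∷ [])) g<v na) ⟩
      a * (wordWeight pre′ g * gapSum F r e (all isValue pre′) g)
        ≈⟨ reflexive (≡.cong (λ s → a * (wordWeight pre′ g * gapSum F r e s g)) (≡.trans (all-isValue-snoc pre (val u)) (∧-identityʳ _))) ⟩
      a * (wordWeight pre′ g * gapSum F r e (all isValue pre) g)
        ≈⟨ sym (*-assoc _ _ _) ⟩
      wordWeight pre (val u ∷ g) * gapSum F r e (all isValue pre) (val u ∷ g) ∎
      where
      F = completion k
      r = gapCount w
      e = endsWithGap w
      pre′ = pre ++ [ val u ]
      a = weight (all (isBelow u) pre) (all (isAbove u) g)
      step : ∀ h → all (isAbove u) h ≡ all (isAbove u) g → weighted k pre (val u ∷ h) ≈ a * weighted k pre′ h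
      step h above≡ = trans (weighted-val∷ k pre u h) (*-cong (reflexive (≡.cong (weight (all (isBelow u) pre)) above≡)) refl)
    ∑-insertions k v pre (gap ∷ g) w pre++g≡w pre<v g<v na = begin
      w₁ + (w₂ + (w₃ + (w₄ + ∑ (weighted k pre) (map (gap ∷_) (insertions v g)))))
        ≈⟨ solve 5 (λ a b c d s → a :+ (b :+ (c :+ (d :+ s))) := (a :+ (b :+ (c :+ d))) :+ s) refl w₁ w₂ w₃ w₄ _ ⟩
      (w₁ + (w₂ + (w₃ + w₄))) + ∑ (weighted k pre) (map (gap ∷_) (insertions v g))
        ≈⟨ +-cong (weighted-fill k v pre g r e (≡.trans (≡.cong gapCount (≡.sym pre++g≡w)) (gapCount-++ pre (gap ∷ g)))
                                             (≡.trans (≡.cong endsWithGap (≡.sym pre++g≡w)) (endsWithGap-++ pre gap g)) pre<v g<v na)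
                  later ⟩
      W * gapFill F r e (all isValue pre) (null g) + W * gapSum F r e false g
        ≈⟨ sym (distribˡ W _ _) ⟩
      W * gapSum F r e (all isValue pre) (gap ∷ g) ∎
      where
      F = completion k
      r = gapCount w
      e = endsWithGap w
      pre′ = pre ++ [ gap ]
      W = wordWeight pre′ g
      w₁ = weighted k pre (val v ∷ g)
      w₂ = weighted k pre (val v ∷ gap ∷ g)
      w₃ = weighted k pre (gap ∷ val v ∷ g)
      w₄ = weighted k pre (gap ∷ val v ∷ gap ∷ g)
      later : ∑ (weighted k pre) (map (gap ∷_) (insertions v g)) ≈ W * gapSum F r e false g
      later = begin
        ∑ (weighted k pre) (map (gap ∷_) (insertions v g))
          ≡⟨ ∑-map (weighted k pre) (gap ∷_) (insertions v g) ⟩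
        ∑ (λ h → weighted k pre (gap ∷ h)) (insertions v g)
          ≈⟨ ∑-cong (insertions v g) (weighted-gap∷ k pre) ⟩
        ∑ (weighted k pre′) (insertions v g)
          ≈⟨ ∑-insertions k v pre′ g w (≡.trans (++-assoc pre [ gap ] g) pre++g≡w)
                                       (values-snoc< pre gap pre<v []) g<v (NoAdjacentGaps-tail g na) ⟩
        W * gapSum F r e (all isValue pre′) g
          ≈⟨ reflexive (≡.cong (λ s → W * gapSum F r e s g) (≡.trans (all-isValue-snoc pre gap) (∧-zeroʳ _))) ⟩
        W * gapSum F r e false g ∎

    ∑-insertions-completion : ∀ k v g → All (_< v) (values g) → NoAdjacentGaps g →
      ∑ (λ h → wordWeight [] h * completionOf k h) (insertions v g) ≈ wordWeight [] g * completionOf (suc k) g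
    ∑-insertions-completion k v g g<v na =
      trans (∑-insertions k v [] g g ≡.refl [] g<v na) (*-cong refl (gapSum-first (completion k) _ _ g))

    -- Sorting permutations by their squashed shape

    permWeight : List ℕ → Carrier
    permWeight π = monomial (RLmin π) (pivot π) (LRmax π)

    module _ (n : ℕ) where

      squashedSum : ℕ → Word → Carrier
      squashedSum i g = ∑ (λ π → indicator (does (squash i (map val π) ≟ʷ g)) * permWeight π) (perms n)

      indicator-squash : ∀ i g π → i < n → Stage i g → IsPerm n π →
        indicator (does (squash i (map val π) ≟ʷ g)) ≈ ∑ (λ h → indicator (does (squash (suc i) (map val π) ≟ʷ h))) (insertions (suc i) g)
      indicator-squash i g π i<n stage isPerm = begin
        indicator (does (squash i (map val π) ≟ʷ g))
          ≡⟨ ≡.cong (λ s → indicator (does (s ≟ʷ g))) (≡.sym (squash-squash i (map val π))) ⟩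
        indicator (does (squash i t ≟ʷ g))
          ≈⟨ sym (nat-one? (does (squash i t ≟ʷ g))) ⟩
        nat (one? (does (squash i t ≟ʷ g)))
          ≡⟨ ≡.cong nat (≡.sym (occurrences-insertions i g t (proj₁ stage) (Stage-values< i g stage) t-gaps t-max)) ⟩
        nat (occurrences _≟ʷ_ t (insertions (suc i) g))
          ≈⟨ sym (∑-indicator _≟ʷ_ t (insertions (suc i) g)) ⟩
        ∑ (λ h → indicator (does (t ≟ʷ h))) (insertions (suc i) g) ∎
        where
        t = squash (suc i) (map val π)
        t-gaps : NoAdjacentGaps t
        t-gaps = NoAdjacentGaps-squash (suc i) (map val π)
        t-max : SoleMaximum (suc i) t
        t-max = squash-SoleMaximum (suc i) π (proj₂ (proj₂ isPerm)) (IsPerm-∈ n π isPerm (s≤s z≤n , i<n))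

      squashedSum-step : ∀ i g → i < n → Stage i g → squashedSum i g ≈ ∑ (squashedSum (suc i)) (insertions (suc i) g)
      squashedSum-step i g i<n stage = begin
        squashedSum i g
          ≈⟨ ∑-congᴬ (perms n) (All.map (λ {π} isPerm → *-cong (indicator-squash i g π i<n stage isPerm) refl) (perms-IsPerm n)) ⟩
        ∑ (λ π → ∑ (δ π) (insertions (suc i) g) * permWeight π) (perms n)
          ≈⟨ ∑-cong (perms n) (λ π → sym (∑-*ʳ (permWeight π) (δ π) (insertions (suc i) g))) ⟩
        ∑ (λ π → ∑ (λ h → δ π h * permWeight π) (insertions (suc i) g)) (perms n)
          ≈⟨ ∑-swap (λ π h → δ π h * permWeight π) (perms n) (insertions (suc i) g) ⟩
        ∑ (squashedSum (suc i)) (insertions (suc i) g) ∎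
        where
        δ : List ℕ → Word → Carrier
        δ π h = indicator (does (squash (suc i) (map val π) ≟ʷ h))

      squashedSum-gapped : ∀ g j → gapCount g ≡ suc j → squashedSum n g ≈ 0#
      squashedSum-gapped g j gaps≡ = begin
        squashedSum n g
          ≈⟨ ∑-congᴬ (perms n) (All.map (λ {π} isPerm → trans (*-cong (reflexive (≡.cong indicator (mismatch π isPerm))) refl) (zeroˡ _))
                                        (perms-IsPerm n)) ⟩
        ∑ (λ _ → 0#) (perms n)
          ≈⟨ ∑-zero (perms n) ⟩
        0# ∎
        where
        mismatch : ∀ π → IsPerm n π → does (squash n (map val π) ≟ʷ g) ≡ false
        mismatch π (_ , inRange , _) = Dec.dec-false (squash n (map val π) ≟ʷ g) λ π≡g →
          ℕ.0≢1+n (≡.trans (≡.sym (gapCount-map-val π))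
                           (≡.trans (≡.cong gapCount (≡.trans (≡.sym (squash-map-val n π inRange)) π≡g)) gaps≡))

      squashedSum-perm : ∀ w → IsPerm n w → squashedSum n (map val w) ≈ permWeight w
      squashedSum-perm w isPerm = begin
        squashedSum n (map val w)
          ≈⟨ ∑-congᴬ (perms n) (All.map (λ {π} (_ , inRange , _) → *-cong (reflexive (≡.cong indicator (match π inRange))) refl)
                                        (perms-IsPerm n)) ⟩
        ∑ (λ π → indicator (does (w ≟ᴺ π)) * permWeight π) (perms n)
          ≈⟨ ∑-cong (perms n) pick ⟩
        ∑ (λ π → indicator (does (w ≟ᴺ π)) * permWeight w) (perms n)
          ≈⟨ ∑-*ʳ (permWeight w) (λ π → indicator (does (w ≟ᴺ π))) (perms n) ⟩
        ∑ (λ π → indicator (does (w ≟ᴺ π))) (perms n) * permWeight w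
          ≈⟨ *-cong (trans (∑-indicator _≟ᴺ_ w (perms n)) (reflexive (≡.cong nat (occurrences-perms n w isPerm)))) refl ⟩
        (1# + 0#) * permWeight w
          ≈⟨ trans (*-cong (+-identityʳ 1#) refl) (*-identityˡ _) ⟩
        permWeight w ∎
        where
        match : ∀ π → All (InRange n) π → does (squash n (map val π) ≟ʷ map val w) ≡ does (w ≟ᴺ π)
        match π inRange = ≡.trans (≡.cong (λ s → does (s ≟ʷ map val w)) (squash-map-val n π inRange))
                                  (≡.trans (does-≟-map-val π w) (does-≟-sym _≟ᴺ_ π w))
        pick : ∀ π → indicator (does (w ≟ᴺ π)) * permWeight π ≈ indicator (does (w ≟ᴺ π)) * permWeight w
        pick π with w ≟ᴺ π
        ... | yes ≡.refl = refl
        ... | no _       = trans (zeroˡ _) (sym (zeroˡ _))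

      squashedSum-Stage : ∀ k i g → i ℕ.+ k ≡ n → Stage i g → squashedSum i g ≈ wordWeight [] g * completionOf k g
      squashedSum-Stage zero i g i+0≡n stage with ≡.trans (≡.sym (ℕ.+-identityʳ i)) i+0≡n | gapCount g in gaps≡
      ... | ≡.refl | suc j = trans (squashedSum-gapped g j gaps≡) (sym (zeroʳ _))
      ... | ≡.refl | zero  = begin
        squashedSum n g                     ≡⟨ ≡.cong (squashedSum n) g≡ ⟩
        squashedSum n (map val (values g))  ≈⟨ squashedSum-perm (values g) (proj₂ stage) ⟩
        permWeight (values g)               ≈⟨ monomial≈wordWeight [] (values g) ⟩
        wordWeight [] (map val (values g))  ≈⟨ sym (trans (*-identityʳ _) (reflexive (≡.cong (wordWeight []) g≡))) ⟩
        wordWeight [] g * 1#                ∎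
        where
        g≡ : g ≡ map val (values g)
        g≡ = gapless⇒map-val g gaps≡
      squashedSum-Stage (suc k) i g i+k≡n stage = begin
        squashedSum i g
          ≈⟨ squashedSum-step i g i<n stage ⟩
        ∑ (squashedSum (suc i)) (insertions (suc i) g)
          ≈⟨ ∑-congᴬ (insertions (suc i) g) (All.map (λ {h} → squashedSum-Stage k (suc i) h (≡.trans (≡.sym (ℕ.+-suc i k)) i+k≡n))
                                                      (insertions-Stage i g stage)) ⟩
        ∑ (λ h → wordWeight [] h * completionOf k h) (insertions (suc i) g)
          ≈⟨ ∑-insertions-completion k (suc i) g (Stage-values< i g stage) (proj₁ stage) ⟩
        wordWeight [] g * completionOf (suc k) g ∎
        where
        i<n : i < n
        i<n = ≡.subst (i <_) i+k≡n (ℕ.m<m+n i (s≤s z≤n))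

    rhs≈completion : ∀ n → rhs (suc n) ≈ completion (suc n) 1 true
    rhs≈completion n = begin
      rhs (suc n)                              ≡⟨ sumR-map permWeight (perms (suc n)) ⟩
      ∑ permWeight (perms (suc n))             ≈⟨ ∑-congᴬ (perms (suc n)) (All.map (λ {π} → squash₀-indicator π) (perms-IsPerm (suc n))) ⟩
      squashedSum (suc n) 0 (gap ∷ [])         ≈⟨ squashedSum-Stage (suc n) (suc n) 0 (gap ∷ []) ≡.refl (tt , ≡.refl , [] , AllPairs.[]) ⟩
      1# * completion (suc n) 1 true           ≈⟨ *-identityˡ _ ⟩
      completion (suc n) 1 true                ∎
      where
      squash₀-indicator : ∀ π → IsPerm (suc n) π → permWeight π ≈ indicator (does (squash 0 (map val π) ≟ʷ (gap ∷ []))) * permWeight π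
      squash₀-indicator []      (() , _)
      squash₀-indicator (x ∷ π) (_ , inRange , _) =
        trans (sym (*-identityˡ _))
              (*-cong (reflexive (≡.cong (λ s → indicator (does (s ≟ʷ (gap ∷ [])))) (≡.sym (squash₀ x π (All.map proj₁ inRange))))) refl)

theorem3p4 : {c ℓ : Level} (R : CommutativeRing c ℓ) (X Y : CommutativeRing.Carrier R)
    → (m : ℕ → CommutativeRing.Carrier R)
    → CommutativeRing._≈_ R (OverRing.𝓛 R m (CommutativeRing.1# R ∷ [])) (CommutativeRing.1# R)
    → (∀ k → CommutativeRing._≈_ R (OverRing.𝓛 R m (OverRing.Seq.p R X Y (suc k))) (CommutativeRing.0# R))
    → ∀ n → CommutativeRing._≈_ R (m n) (OverRing.Seq.rhs R X Y n)
theorem3p4 R X Y m 𝓛1≈1 𝓛p≈0 = moment≈rhs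
  where
  open CommutativeRing R
  open OverRing R
  open Seq X Y
  open import Relation.Binary.Reasoning.Setoid setoid

  moment≈rhs : ∀ n → m n ≈ rhs n
  moment≈rhs zero    = begin
    m 0                              ≈⟨ moment≈pathSum R X Y m 𝓛1≈1 𝓛p≈0 0 ⟩
    1#                               ≈⟨ sym (trans (+-identityʳ _) (trans (*-identityʳ _) (*-identityʳ _))) ⟩
    rhs 0                            ∎
  moment≈rhs (suc n) = begin
    m (suc n)                        ≈⟨ moment≈pathSum R X Y m 𝓛1≈1 𝓛p≈0 (suc n) ⟩
    pathSum R X Y (suc n) 0          ≈⟨ sym (completion≈pathSum R X Y (suc n) 0) ⟩
    completion R X Y (suc n) 1 true + 0# ≈⟨ +-identityʳ _ ⟩
    completion R X Y (suc n) 1 true  ≈⟨ sym (rhs≈completion R X Y n) ⟩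
    rhs (suc n)                      ∎
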